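{- Let $k\ge 2$ and $t\ge 2$ be integers, and let $P_1,P_2,\dots,P_k$ be posets in which every element lies in at least one $t$-chain. For $1\le i\le k$ let $n_i=|P_i|$ and let $m_i$ be the number of $t$-chains in $P_i$, where $2\le t\le n_1\le n_2\le\cdots\le n_k$ and $3\le n_k$. Let $m=\min\{m_1,m_2,\dots,m_{k-1}\}$, assume $m\ge 1$, and let $d=\binom{n_k}{t}-m_k$. Then there exists a constant $C_0>0$ depending only on $k,t,P_1,\dots,P_{k-1}$ such that, whenever a positive integer $n$ satisfies \[ \ln n<\frac{m_k}{n_k+td+2}\qquad\text{and}\qquad (\ln n)^m\, n^{n_{k-1}}<C_0\left(\frac{m_k}{n_k+td+2}\right)^m, \] then for every poset $Q$ with $n$ elements there exists a $k$-coloring of the $t$-chains of $Q$ such that, for no $i\in\{1,\dots,k\}$, $Q$ contains a monochromatic copy of $P_i$ in color $i$.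
   Context: A $t$-chain in a poset is a set of $t$ distinct pairwise comparable elements. A $k$-coloring of the $t$-chains of $Q$ assigns to each $t$-chain of $Q$ one of the colors $1,\dots,k$. A copy of a poset $P$ in $Q$ is given by an injection $f:P\to Q$ such that $f(x)\le f(y)$ in $Q$ whenever $x\le y$ in $P$ (a weak embedding); it is a monochromatic copy of $P$ in color $i$ if for every $t$-chain $C$ of $P$ the $t$-chain $f(C)$ of $Q$ has color $i$. -}

module Defs where

open import Data.Bool using (Bool; true; false; T)
open import Data.Bool.Properties using (T?)
open import Data.Nat as ℕ using (ℕ; zero; suc)
open import Data.Fin as Fin using (Fin)
open import Data.Fin.Subset using (Subset; _∈_; ∣_∣)
open import Data.Fin.Subset.Properties using (_∈?_)
open import Data.Fin.Properties using (all?; any?)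
open import Data.Integer using (+_)
open import Data.Rational as ℚ using (ℚ; 0ℚ; 1ℚ; _/_)
open import Data.List using (List; []; _∷_; _++_; map; filter; length)
open import Data.Vec using (Vec; []; _∷_; tabulate)
open import Data.Product using (Σ; ∃; _×_; _,_)
open import Data.Sum using (_⊎_)
open import Function.Definitions using (Injective)
open import Relation.Nullary using (Dec; does)
open import Relation.Nullary.Decidable using (_×-dec_; _⊎-dec_; _→-dec_)
open import Relation.Binary.PropositionalEquality using (_≡_)

record FinPoset : Set where
  field
    size     : ℕ
    leq      : Fin size → Fin size → Bool
    reflexive : ∀ x → T (leq x x)
    antisym  : ∀ x y → T (leq x y) → T (leq y x) → x ≡ y
    transitive : ∀ x y z → T (leq x y) → T (leq y z) → T (leq x z)

open FinPoset public

Le : (P : FinPoset) → Fin (size P) → Fin (size P) → Set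
Le P x y = T (leq P x y)

Comparable : (P : FinPoset) → Fin (size P) → Fin (size P) → Set
Comparable P x y = Le P x y ⊎ Le P y x

IsChain : (P : FinPoset) → ℕ → Subset (size P) → Set
IsChain P t S = (∣ S ∣ ≡ t) × (∀ x y → x ∈ S → y ∈ S → Comparable P x y)

isChain? : (P : FinPoset) (t : ℕ) (S : Subset (size P)) → Dec (IsChain P t S)
isChain? P t S =
  (∣ S ∣ ℕ.≟ t) ×-dec
  all? (λ x → all? (λ y → (x ∈? S) →-dec ((y ∈? S) →-dec
    (T? (leq P x y) ⊎-dec T? (leq P y x)))))

allSubsets : (n : ℕ) → List (Subset n)
allSubsets zero = [] ∷ []
allSubsets (suc n) = map (true ∷_) (allSubsets n) ++ map (false ∷_) (allSubsets n)

numChains : FinPoset → ℕ → ℕ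
numChains P t = length (filter (isChain? P t) (allSubsets (size P)))

EveryElemInChain : FinPoset → ℕ → Set
EveryElemInChain P t = ∀ x → ∃ λ S → IsChain P t S × x ∈ S

-- a k-colouring of the t-chains of Q (values on non-chains are irrelevant)
Coloring : FinPoset → ℕ → Set
Coloring Q k = Subset (size Q) → Fin k

image : ∀ {p q} → (Fin p → Fin q) → Subset p → Subset q
image f S = tabulate (λ y → does (any? (λ x → (x ∈? S) ×-dec (f x Fin.≟ y))))

IsCopy : (P Q : FinPoset) → (Fin (size P) → Fin (size Q)) → Set
IsCopy P Q f = Injective _≡_ _≡_ f × (∀ x y → Le P x y → Le Q (f x) (f y))

MonoCopy : (P Q : FinPoset) (t : ℕ) {k : ℕ} → Coloring Q k → Fin k → Set
MonoCopy P Q t c i =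
  Σ (Fin (size P) → Fin (size Q)) λ f →
    IsCopy P Q f × (∀ C → IsChain P t C → c (image f C) ≡ i)

minFin : ∀ {k} → (Fin (suc k) → ℕ) → ℕ
minFin {zero} f = f Fin.zero
minFin {suc k} f = f Fin.zero ℕ.⊓ minFin (λ i → f (Fin.suc i))

ℕ→ℚ : ℕ → ℚ
ℕ→ℚ n = (+ n) / 1

_^ℚ_ : ℚ → ℕ → ℚ
q ^ℚ zero = 1ℚ
q ^ℚ suc j = q ^ℚ j ℚ.* q

expTerm : ℚ → ℕ → ℚ
expTerm q zero = 1ℚ
expTerm q (suc j) = expTerm q j ℚ.* q ℚ.* ((+ 1) / suc j)

expPartial : ℚ → ℕ → ℚ
expPartial q zero = 0ℚ
expPartial q (suc N) = expPartial q N ℚ.+ expTerm q N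

-- "ln n < q" for a positive integer n and rational q:
-- equivalent to q > 0 and n < e^q = sup_N Σ_{j<N} q^j/j!  (partial sums
-- increase strictly to e^q when q > 0).
LnLt : ℕ → ℚ → Set
LnLt n q = (0ℚ ℚ.< q) × ∃ λ N → ℕ→ℚ n ℚ.< expPartial q N

{-# OPTIONS --safe #-}
-- Colour the t-chains of Q independently at random: each of the first k - 1 colours with
-- probability p/(k - 1) and the last one with probability 1 - p, where p = 3q/r and
-- r = mₖ/(nₖ + t d + 2).  Pᵢ has at most n^nᵢ copies in Q, each monochromatic in colour i with
-- probability (p/(k - 1))^mᵢ, resp. (1 - p)^mₖ, so the expected number of bad copies is at most
-- (k - 1) n^nₖ₋₁ pᵐ + n^nₖ (1 - p)^mₖ.  The choice of C₀ makes the first term less than ½, and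
-- since ln n < q ≤ p ⌊mₖ/(nₖ + 1)⌋ the second is at most 1/n ≤ ½.  The method of conditional
-- expectations then fixes the colours one chain at a time, never increasing the expectation,
-- which stays below 1.  As ln n < q means n < Σ_{j<N} qʲ/j!, the bound (1 - p)ᴹ e^(pM) ≤ 1 is
-- proved rationally by comparing e^(pM) termwise with the binomial series of (1 - p)⁻ᴹ.
module Submission where

open import Defs
open import Data.Nat using (ℕ; suc)
open import Data.Fin as Fin using (Fin; zero; fromℕ; inject₁)
open import Data.Integer using (+_)
open import Data.Rational as ℚ using (ℚ; 0ℚ; 1ℚ; _/_)
open import Data.Product using (Σ; ∃; _×_; _,_)
open import Relation.Nullary using (¬_)
open import Relation.Binary.PropositionalEquality using (_≡_; refl)
open import Relation.Binary.Definitions using (DecidableEquality)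
open import Algebra.Bundles using (CommutativeRing)
open import Data.Rational.Properties using (+-*-commutativeRing)
open import Algebra.Properties.Semiring.Sum (CommutativeRing.semiring +-*-commutativeRing)
  using (sum; sum-syntax; sum-cong-≗; ∑-distrib-+; *-distribˡ-sum; *-distribʳ-sum; sum-init-last)

module RationalArithmetic where
  open import Data.Nat as ℕ using (ℕ; zero; suc)
  import Data.Nat.Properties as ℕ
  open import Data.Integer as ℤ using (+_)
  import Data.Integer.Properties as ℤ
  import Data.Nat.Coprimality as Coprimality
  open import Data.Rational
  open import Data.Rational.Properties
  import Data.Rational.Unnormalised as ℚᵘ
  import Data.Rational.Unnormalised.Properties as ℚᵘ
  open import Data.Rational.Solver using (module +-*-Solver)
  open +-*-Solver
  open import Relation.Binary.PropositionalEquality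

  0≤1 : 0ℚ ≤ 1ℚ
  0≤1 = *≤* (ℤ.+≤+ ℕ.z≤n)

  0<1 : 0ℚ < 1ℚ
  0<1 = *<* (ℤ.+<+ (ℕ.s≤s ℕ.z≤n))

  ℕ→ℚ≡mkℚ : ∀ a → ℕ→ℚ a ≡ mkℚ (+ a) 0 (Coprimality.sym (Coprimality.1-coprimeTo a))
  ℕ→ℚ≡mkℚ a = normalize-coprime _

  ℕ→ℚ-+ : ∀ a b → ℕ→ℚ (a ℕ.+ b) ≡ ℕ→ℚ a + ℕ→ℚ b
  ℕ→ℚ-+ a b rewrite ℕ→ℚ≡mkℚ a | ℕ→ℚ≡mkℚ b =
    cong (_/ 1) (sym (cong₂ ℤ._+_ (ℤ.*-identityʳ (+ a)) (ℤ.*-identityʳ (+ b))))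

  ℕ→ℚ-* : ∀ a b → ℕ→ℚ (a ℕ.* b) ≡ ℕ→ℚ a * ℕ→ℚ b
  ℕ→ℚ-* a b rewrite ℕ→ℚ≡mkℚ a | ℕ→ℚ≡mkℚ b = cong (_/ 1) (ℤ.pos-* a b)

  ℕ→ℚ-^ : ∀ a b → ℕ→ℚ (a ℕ.^ b) ≡ ℕ→ℚ a ^ℚ b
  ℕ→ℚ-^ a zero = refl
  ℕ→ℚ-^ a (suc b) = begin
    ℕ→ℚ (a ℕ.* a ℕ.^ b)    ≡⟨ ℕ→ℚ-* a (a ℕ.^ b) ⟩
    ℕ→ℚ a * ℕ→ℚ (a ℕ.^ b)  ≡⟨ cong (ℕ→ℚ a *_) (ℕ→ℚ-^ a b) ⟩
    ℕ→ℚ a * ℕ→ℚ a ^ℚ b     ≡⟨ *-comm (ℕ→ℚ a) _ ⟩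
    ℕ→ℚ a ^ℚ b * ℕ→ℚ a     ∎
    where open ≡-Reasoning

  ℕ→ℚ-mono-≤ : ∀ {a b} → a ℕ.≤ b → ℕ→ℚ a ≤ ℕ→ℚ b
  ℕ→ℚ-mono-≤ {a} {b} a≤b rewrite ℕ→ℚ≡mkℚ a | ℕ→ℚ≡mkℚ b =
    *≤* (subst₂ ℤ._≤_ (sym (ℤ.*-identityʳ (+ a))) (sym (ℤ.*-identityʳ (+ b))) (ℤ.+≤+ a≤b))

  ℕ→ℚ-nonNeg : ∀ a → 0ℚ ≤ ℕ→ℚ a
  ℕ→ℚ-nonNeg a = ℕ→ℚ-mono-≤ {0} {a} ℕ.z≤n

  ℕ→ℚ-pos : ∀ {a} → 0 ℕ.< a → 0ℚ < ℕ→ℚ a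
  ℕ→ℚ-pos {a} 0<a = <-≤-trans 0<1 (ℕ→ℚ-mono-≤ {1} {a} 0<a)

  /-*-cancel : ∀ a b → ((+ a) / suc b) * ℕ→ℚ (suc b) ≡ ℕ→ℚ a
  /-*-cancel a b = toℚᵘ-injective (begin
      toℚᵘ ((+ a / suc b) * ℕ→ℚ (suc b))
        ≈⟨ toℚᵘ-homo-* (+ a / suc b) (ℕ→ℚ (suc b)) ⟩
      toℚᵘ (+ a / suc b) ℚᵘ.* toℚᵘ (ℕ→ℚ (suc b))
        ≈⟨ ℚᵘ.*-cong (toℚᵘ-fromℚᵘ (ℚᵘ.mkℚᵘ (+ a) b)) (toℚᵘ-fromℚᵘ (ℚᵘ.mkℚᵘ (+ suc b) 0)) ⟩
      ℚᵘ.mkℚᵘ (+ a) b ℚᵘ.* ℚᵘ.mkℚᵘ (+ suc b) 0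
        ≈⟨ ℚᵘ.*≡* cross-multiplied ⟩
      ℚᵘ.mkℚᵘ (+ a) 0
        ≈⟨ toℚᵘ-fromℚᵘ (ℚᵘ.mkℚᵘ (+ a) 0) ⟨
      toℚᵘ (ℕ→ℚ a) ∎)
    where
    open ℚᵘ.≃-Reasoning
    cross-multiplied : (+ a ℤ.* + suc b) ℤ.* + 1 ≡ + a ℤ.* + suc (b ℕ.* 1)
    cross-multiplied =
      trans (ℤ.*-identityʳ _) (cong (λ z → + a ℤ.* + suc z) (sym (ℕ.*-identityʳ b)))

  *-monoˡ-≤-0≤ : ∀ {a x y} → 0ℚ ≤ a → x ≤ y → a * x ≤ a * y
  *-monoˡ-≤-0≤ {a} 0≤a = *-monoˡ-≤-nonNeg a {{nonNegative 0≤a}}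

  *-monoʳ-≤-0≤ : ∀ {a x y} → 0ℚ ≤ a → x ≤ y → x * a ≤ y * a
  *-monoʳ-≤-0≤ {a} 0≤a = *-monoʳ-≤-nonNeg a {{nonNegative 0≤a}}

  *-mono-≤-0≤ : ∀ {a b c d} → 0ℚ ≤ a → 0ℚ ≤ c → a ≤ b → c ≤ d → a * c ≤ b * d
  *-mono-≤-0≤ 0≤a 0≤c a≤b c≤d =
    ≤-trans (*-monoʳ-≤-0≤ 0≤c a≤b) (*-monoˡ-≤-0≤ (≤-trans 0≤a a≤b) c≤d)

  *-monoˡ-<-0< : ∀ {a x y} → 0ℚ < a → x < y → a * x < a * y
  *-monoˡ-<-0< {a} 0<a = *-monoʳ-<-pos a {{positive 0<a}}

  *-nonNeg : ∀ {a b} → 0ℚ ≤ a → 0ℚ ≤ b → 0ℚ ≤ a * b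
  *-nonNeg {a} {b} 0≤a 0≤b = ≤-trans (≤-reflexive (sym (*-zeroˡ b))) (*-monoʳ-≤-0≤ 0≤b 0≤a)

  +-nonNeg : ∀ {a b} → 0ℚ ≤ a → 0ℚ ≤ b → 0ℚ ≤ a + b
  +-nonNeg = +-mono-≤

  ≤-+-nonNeg : ∀ a {b} → 0ℚ ≤ b → a ≤ a + b
  ≤-+-nonNeg a 0≤b = ≤-trans (≤-reflexive (sym (+-identityʳ a))) (+-monoʳ-≤ a 0≤b)

  +-cancelʳ-≤ : ∀ {a b} c → a + c ≤ b + c → a ≤ b
  +-cancelʳ-≤ {a} {b} c a+c≤b+c = begin
    a          ≡⟨ solve 2 (λ x y → x := x :+ y :- y) refl a c ⟩
    a + c - c  ≤⟨ +-monoˡ-≤ (- c) a+c≤b+c ⟩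
    b + c - c  ≡⟨ solve 2 (λ x y → x :+ y :- y := x) refl b c ⟩
    b          ∎
    where open ≤-Reasoning

  1-p-nonNeg : ∀ {p} → p ≤ 1ℚ → 0ℚ ≤ 1ℚ - p
  1-p-nonNeg {p} p≤1 = ≤-trans (≤-reflexive (sym (+-inverseʳ p))) (+-monoˡ-≤ (- p) p≤1)

  1-p≤1 : ∀ {p} → 0ℚ ≤ p → 1ℚ - p ≤ 1ℚ
  1-p≤1 0≤p = +-monoʳ-≤ 1ℚ (neg-antimono-≤ 0≤p)

  ^ℚ-nonNeg : ∀ {x} j → 0ℚ ≤ x → 0ℚ ≤ x ^ℚ j
  ^ℚ-nonNeg zero    0≤x = 0≤1
  ^ℚ-nonNeg (suc j) 0≤x = *-nonNeg (^ℚ-nonNeg j 0≤x) 0≤x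

  ^ℚ-monoˡ-≤ : ∀ {x y} j → 0ℚ ≤ x → x ≤ y → x ^ℚ j ≤ y ^ℚ j
  ^ℚ-monoˡ-≤ zero    0≤x x≤y = ≤-refl
  ^ℚ-monoˡ-≤ (suc j) 0≤x x≤y = *-mono-≤-0≤ (^ℚ-nonNeg j 0≤x) 0≤x (^ℚ-monoˡ-≤ j 0≤x x≤y) x≤y

  ^ℚ-distribʳ-* : ∀ x y j → (x * y) ^ℚ j ≡ x ^ℚ j * y ^ℚ j
  ^ℚ-distribʳ-* x y zero = refl
  ^ℚ-distribʳ-* x y (suc j) rewrite ^ℚ-distribʳ-* x y j =
    solve 4 (λ a b c d → (a :* b) :* (c :* d) := (a :* c) :* (b :* d)) refl (x ^ℚ j) (y ^ℚ j) x y

  ^ℚ-homo-+ : ∀ x i j → x ^ℚ (i ℕ.+ j) ≡ x ^ℚ i * x ^ℚ j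
  ^ℚ-homo-+ x zero    j = sym (*-identityˡ _)
  ^ℚ-homo-+ x (suc i) j rewrite ^ℚ-homo-+ x i j =
    solve 3 (λ a b c → (a :* b) :* c := (a :* c) :* b) refl (x ^ℚ i) (x ^ℚ j) x

  ^ℚ-assocʳ : ∀ x i j → (x ^ℚ i) ^ℚ j ≡ x ^ℚ (j ℕ.* i)
  ^ℚ-assocʳ x i zero    = refl
  ^ℚ-assocʳ x i (suc j) rewrite ^ℚ-assocʳ x i j =
    trans (sym (^ℚ-homo-+ x (j ℕ.* i) i)) (cong (x ^ℚ_) (ℕ.+-comm (j ℕ.* i) i))

  1^ℚ : ∀ j → 1ℚ ^ℚ j ≡ 1ℚ
  1^ℚ zero    = refl
  1^ℚ (suc j) rewrite 1^ℚ j = refl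

  ^ℚ-≤1 : ∀ {x} j → 0ℚ ≤ x → x ≤ 1ℚ → x ^ℚ j ≤ 1ℚ
  ^ℚ-≤1 j 0≤x x≤1 = ≤-trans (^ℚ-monoˡ-≤ j 0≤x x≤1) (≤-reflexive (1^ℚ j))

  ^ℚ-≥1 : ∀ {x} j → 1ℚ ≤ x → 1ℚ ≤ x ^ℚ j
  ^ℚ-≥1 j 1≤x = ≤-trans (≤-reflexive (sym (1^ℚ j))) (^ℚ-monoˡ-≤ j 0≤1 1≤x)

  ^ℚ-antimonoʳ-≤ : ∀ {x i j} → 0ℚ ≤ x → x ≤ 1ℚ → i ℕ.≤ j → x ^ℚ j ≤ x ^ℚ i
  ^ℚ-antimonoʳ-≤ {x} {i} {j} 0≤x x≤1 i≤j = begin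
    x ^ℚ j                    ≡⟨ cong (x ^ℚ_) (sym (ℕ.m+[n∸m]≡n i≤j)) ⟩
    x ^ℚ (i ℕ.+ (j ℕ.∸ i))    ≡⟨ ^ℚ-homo-+ x i (j ℕ.∸ i) ⟩
    x ^ℚ i * x ^ℚ (j ℕ.∸ i)   ≤⟨ *-monoˡ-≤-0≤ (^ℚ-nonNeg i 0≤x) (^ℚ-≤1 (j ℕ.∸ i) 0≤x x≤1) ⟩
    x ^ℚ i * 1ℚ               ≡⟨ *-identityʳ _ ⟩
    x ^ℚ i                    ∎
    where open ≤-Reasoning

  ^ℚ-monoʳ-≤ : ∀ {x i j} → 1ℚ ≤ x → i ℕ.≤ j → x ^ℚ i ≤ x ^ℚ j
  ^ℚ-monoʳ-≤ {x} {i} {j} 1≤x i≤j = begin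
    x ^ℚ i                    ≡⟨ *-identityʳ _ ⟨
    x ^ℚ i * 1ℚ               ≤⟨ *-monoˡ-≤-0≤ (^ℚ-nonNeg i (≤-trans 0≤1 1≤x)) (^ℚ-≥1 (j ℕ.∸ i) 1≤x) ⟩
    x ^ℚ i * x ^ℚ (j ℕ.∸ i)   ≡⟨ ^ℚ-homo-+ x i (j ℕ.∸ i) ⟨
    x ^ℚ (i ℕ.+ (j ℕ.∸ i))    ≡⟨ cong (x ^ℚ_) (ℕ.m+[n∸m]≡n i≤j) ⟩
    x ^ℚ j                    ∎
    where open ≤-Reasoning

module ExponentialSeries where
  open import Data.Nat as ℕ using (ℕ; zero; suc)
  import Data.Nat.Properties as ℕ
  open import Data.Integer using (+_)
  open import Data.Rational
  open import Data.Rational.Properties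
  open import Data.Rational.Solver using (module +-*-Solver)
  open +-*-Solver
  open import Relation.Binary.PropositionalEquality
  open RationalArithmetic

  1/suc : ℕ → ℚ
  1/suc j = (+ 1) / suc j

  1/suc-nonNeg : ∀ j → 0ℚ ≤ 1/suc j
  1/suc-nonNeg j = nonNegative⁻¹ (1/suc j) {{normalize-nonNeg 1 (suc j)}}

  1/suc-*-cancel : ∀ j → 1/suc j * ℕ→ℚ (suc j) ≡ 1ℚ
  1/suc-*-cancel j = /-*-cancel 1 j

  1/suc≤1 : ∀ j → 1/suc j ≤ 1ℚ
  1/suc≤1 j = begin
    1/suc j                  ≡⟨ *-identityʳ (1/suc j) ⟨
    1/suc j * 1ℚ             ≤⟨ *-monoˡ-≤-0≤ (1/suc-nonNeg j) (ℕ→ℚ-mono-≤ {1} {suc j} (ℕ.s≤s ℕ.z≤n)) ⟩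
    1/suc j * ℕ→ℚ (suc j)    ≡⟨ 1/suc-*-cancel j ⟩
    1ℚ                       ∎
    where open ≤-Reasoning

  expTerm-nonNeg : ∀ {x} j → 0ℚ ≤ x → 0ℚ ≤ expTerm x j
  expTerm-nonNeg zero    0≤x = 0≤1
  expTerm-nonNeg (suc j) 0≤x = *-nonNeg (*-nonNeg (expTerm-nonNeg j 0≤x) 0≤x) (1/suc-nonNeg j)

  expTerm-monoˡ-≤ : ∀ {x y} j → 0ℚ ≤ x → x ≤ y → expTerm x j ≤ expTerm y j
  expTerm-monoˡ-≤ zero    0≤x x≤y = ≤-refl
  expTerm-monoˡ-≤ (suc j) 0≤x x≤y =
    *-monoʳ-≤-0≤ (1/suc-nonNeg j) (*-mono-≤-0≤ (expTerm-nonNeg j 0≤x) 0≤x (expTerm-monoˡ-≤ j 0≤x x≤y) x≤y)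

  expPartial-monoˡ-≤ : ∀ {x y} N → 0ℚ ≤ x → x ≤ y → expPartial x N ≤ expPartial y N
  expPartial-monoˡ-≤ zero    0≤x x≤y = ≤-refl
  expPartial-monoˡ-≤ (suc N) 0≤x x≤y =
    +-mono-≤ (expPartial-monoˡ-≤ N 0≤x x≤y) (expTerm-monoˡ-≤ N 0≤x x≤y)

  expTerm≤½^ : ∀ {q} j → 0ℚ ≤ q → q ≤ ½ → expTerm q j ≤ ½ ^ℚ j
  expTerm≤½^ zero    0≤q q≤½ = ≤-refl
  expTerm≤½^ {q} (suc j) 0≤q q≤½ = begin
    expTerm q j * q * 1/suc j   ≤⟨ *-monoˡ-≤-0≤ (*-nonNeg (expTerm-nonNeg j 0≤q) 0≤q) (1/suc≤1 j) ⟩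
    expTerm q j * q * 1ℚ        ≡⟨ *-identityʳ _ ⟩
    expTerm q j * q             ≤⟨ *-mono-≤-0≤ (expTerm-nonNeg j 0≤q) 0≤q (expTerm≤½^ j 0≤q q≤½) q≤½ ⟩
    ½ ^ℚ j * ½                  ∎
    where open ≤-Reasoning

  -- The geometric tail 2·½ᴺ is the slack that makes the induction go through.
  expPartial+tail≤2 : ∀ {q} N → 0ℚ ≤ q → q ≤ ½ → expPartial q N + ℕ→ℚ 2 * ½ ^ℚ N ≤ ℕ→ℚ 2
  expPartial+tail≤2 zero 0≤q q≤½ = ≤-refl
  expPartial+tail≤2 {q} (suc N) 0≤q q≤½ = begin
    E + expTerm q N + two * (½ ^ℚ N * ½)
      ≤⟨ +-monoˡ-≤ (two * (½ ^ℚ N * ½)) (+-monoʳ-≤ E (expTerm≤½^ N 0≤q q≤½)) ⟩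
    E + ½ ^ℚ N + two * (½ ^ℚ N * ½)
      ≡⟨ solve 2 (λ e h → e :+ h :+ con two :* (h :* con ½) := e :+ con two :* h) refl E (½ ^ℚ N) ⟩
    E + two * ½ ^ℚ N
      ≤⟨ expPartial+tail≤2 N 0≤q q≤½ ⟩
    two ∎
    where
    open ≤-Reasoning
    E = expPartial q N
    two = ℕ→ℚ 2

  expPartial≤2 : ∀ {q} N → 0ℚ ≤ q → q ≤ ½ → expPartial q N ≤ ℕ→ℚ 2
  expPartial≤2 {q} N 0≤q q≤½ =
    ≤-trans (≤-+-nonNeg (expPartial q N) (*-nonNeg (ℕ→ℚ-nonNeg 2) (^ℚ-nonNeg N (1/suc-nonNeg 1))))
            (expPartial+tail≤2 N 0≤q q≤½)

  -- negBinomialTerm p M j = C(M+j-1, j) pʲ is the j-th coefficient of (1 - p)⁻ᴹ.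
  negBinomialTerm : ℚ → ℕ → ℕ → ℚ
  negBinomialTerm p M zero    = 1ℚ
  negBinomialTerm p M (suc j) = negBinomialTerm p M j * (p * ℕ→ℚ (M ℕ.+ j)) * 1/suc j

  negBinomialSum : ℚ → ℕ → ℕ → ℚ
  negBinomialSum p M zero    = 0ℚ
  negBinomialSum p M (suc N) = negBinomialSum p M N + negBinomialTerm p M N

  negBinomialTerm-nonNeg : ∀ {p} M j → 0ℚ ≤ p → 0ℚ ≤ negBinomialTerm p M j
  negBinomialTerm-nonNeg M zero    0≤p = 0≤1
  negBinomialTerm-nonNeg M (suc j) 0≤p =
    *-nonNeg (*-nonNeg (negBinomialTerm-nonNeg M j 0≤p) (*-nonNeg 0≤p (ℕ→ℚ-nonNeg (M ℕ.+ j))))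
             (1/suc-nonNeg j)

  expTerm≤negBinomialTerm : ∀ {p} M j → 0ℚ ≤ p → expTerm (p * ℕ→ℚ M) j ≤ negBinomialTerm p M j
  expTerm≤negBinomialTerm M zero    0≤p = ≤-refl
  expTerm≤negBinomialTerm M (suc j) 0≤p =
    *-monoʳ-≤-0≤ (1/suc-nonNeg j)
      (*-mono-≤-0≤ (expTerm-nonNeg j 0≤pM) 0≤pM (expTerm≤negBinomialTerm M j 0≤p)
                   (*-monoˡ-≤-0≤ 0≤p (ℕ→ℚ-mono-≤ (ℕ.m≤m+n M j))))
    where 0≤pM = *-nonNeg 0≤p (ℕ→ℚ-nonNeg M)

  expPartial≤negBinomialSum : ∀ {p} M N → 0ℚ ≤ p → expPartial (p * ℕ→ℚ M) N ≤ negBinomialSum p M N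
  expPartial≤negBinomialSum M zero    0≤p = ≤-refl
  expPartial≤negBinomialSum M (suc N) 0≤p =
    +-mono-≤ (expPartial≤negBinomialSum M N 0≤p) (expTerm≤negBinomialTerm M N 0≤p)

  negBinomialTerm-shift : ∀ p M j →
    ℕ→ℚ M * negBinomialTerm p (suc M) j ≡ ℕ→ℚ (M ℕ.+ j) * negBinomialTerm p M j
  negBinomialTerm-shift p M zero = cong (λ z → ℕ→ℚ z * 1ℚ) (sym (ℕ.+-identityʳ M))
  negBinomialTerm-shift p M (suc j) = begin
    ℕ→ℚ M * (T′ * (p * B) * 1/suc j)
      ≡⟨ solve 5 (λ m t q b u → m :* (t :* (q :* b) :* u) := (m :* t) :* (q :* b) :* u) refl (ℕ→ℚ M) T′ p B (1/suc j) ⟩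
    (ℕ→ℚ M * T′) * (p * B) * 1/suc j
      ≡⟨ cong (λ z → z * (p * B) * 1/suc j) (negBinomialTerm-shift p M j) ⟩
    (A * T) * (p * B) * 1/suc j
      ≡⟨ solve 5 (λ a t q b u → (a :* t) :* (q :* b) :* u := b :* (t :* (q :* a) :* u)) refl A T p B (1/suc j) ⟩
    B * (T * (p * A) * 1/suc j)
      ≡⟨ cong (λ z → ℕ→ℚ z * (T * (p * A) * 1/suc j)) (sym (ℕ.+-suc M j)) ⟩
    ℕ→ℚ (M ℕ.+ suc j) * (T * (p * A) * 1/suc j) ∎
    where
    open ≡-Reasoning
    T′ = negBinomialTerm p (suc M) j
    T  = negBinomialTerm p M j
    A  = ℕ→ℚ (M ℕ.+ j)
    B  = ℕ→ℚ (suc (M ℕ.+ j))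

  negBinomialTerm-pascal : ∀ p M j →
    negBinomialTerm p (suc M) (suc j) ≡ p * negBinomialTerm p (suc M) j + negBinomialTerm p M (suc j)
  negBinomialTerm-pascal p M j = begin
    T′ * (p * ℕ→ℚ (suc (M ℕ.+ j))) * 1/suc j
      ≡⟨ cong (λ z → T′ * (p * z) * 1/suc j) M+1+j≡M+[1+j] ⟩
    T′ * (p * (ℕ→ℚ M + ℕ→ℚ (suc j))) * 1/suc j
      ≡⟨ solve 5 (λ t q m s u → t :* (q :* (m :+ s)) :* u := q :* u :* (m :* t) :+ q :* t :* (u :* s))
               refl T′ p (ℕ→ℚ M) (ℕ→ℚ (suc j)) (1/suc j) ⟩
    p * 1/suc j * (ℕ→ℚ M * T′) + p * T′ * (1/suc j * ℕ→ℚ (suc j))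
      ≡⟨ cong₂ (λ z w → p * 1/suc j * z + p * T′ * w) (negBinomialTerm-shift p M j) (1/suc-*-cancel j) ⟩
    p * 1/suc j * (A * T) + p * T′ * 1ℚ
      ≡⟨ solve 5 (λ t′ q a t u → q :* u :* (a :* t) :+ q :* t′ :* con 1ℚ := q :* t′ :+ t :* (q :* a) :* u)
               refl T′ p A T (1/suc j) ⟩
    p * T′ + T * (p * A) * 1/suc j ∎
    where
    open ≡-Reasoning
    T′ = negBinomialTerm p (suc M) j
    T  = negBinomialTerm p M j
    A  = ℕ→ℚ (M ℕ.+ j)
    M+1+j≡M+[1+j] : ℕ→ℚ (suc (M ℕ.+ j)) ≡ ℕ→ℚ M + ℕ→ℚ (suc j)
    M+1+j≡M+[1+j] = trans (cong ℕ→ℚ (sym (ℕ.+-suc M j))) (ℕ→ℚ-+ M (suc j))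

  negBinomialSum-pascal : ∀ p M N →
    negBinomialSum p (suc M) (suc N) ≡ p * negBinomialSum p (suc M) N + negBinomialSum p M (suc N)
  negBinomialSum-pascal p M zero =
    solve 1 (λ q → con 0ℚ :+ con 1ℚ := q :* con 0ℚ :+ (con 0ℚ :+ con 1ℚ)) refl p
  negBinomialSum-pascal p M (suc N) = begin
    negBinomialSum p (suc M) (suc N) + negBinomialTerm p (suc M) (suc N)
      ≡⟨ cong₂ _+_ (negBinomialSum-pascal p M N) (negBinomialTerm-pascal p M N) ⟩
    (p * a + b) + (p * c + d)
      ≡⟨ solve 5 (λ q a b c d → (q :* a :+ b) :+ (q :* c :+ d) := q :* (a :+ c) :+ (b :+ d)) refl p a b c d ⟩
    p * (a + c) + (b + d) ∎
    where
    open ≡-Reasoning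
    a = negBinomialSum p (suc M) N
    b = negBinomialSum p M (suc N)
    c = negBinomialTerm p (suc M) N
    d = negBinomialTerm p M (suc N)

  negBinomialSum-step : ∀ p M N → 0ℚ ≤ p →
    (1ℚ - p) * negBinomialSum p (suc M) N ≤ negBinomialSum p M (suc N)
  negBinomialSum-step p M N 0≤p = begin
    (1ℚ - p) * S′                            ≡⟨ solve 2 (λ q s → (con 1ℚ :- q) :* s := s :- q :* s) refl p S′ ⟩
    S′ - p * S′                              ≤⟨ +-monoˡ-≤ (- (p * S′)) (≤-+-nonNeg S′ (negBinomialTerm-nonNeg (suc M) N 0≤p)) ⟩
    (S′ + negBinomialTerm p (suc M) N) - p * S′ ≡⟨ cong (_- (p * S′)) (negBinomialSum-pascal p M N) ⟩
    (p * S′ + negBinomialSum p M (suc N)) - p * S′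
      ≡⟨ solve 2 (λ a b → (a :+ b) :- a := b) refl (p * S′) (negBinomialSum p M (suc N)) ⟩
    negBinomialSum p M (suc N)               ∎
    where
    open ≤-Reasoning
    S′ = negBinomialSum p (suc M) N

  negBinomialTerm-zero : ∀ p j → negBinomialTerm p 0 (suc j) ≡ 0ℚ
  negBinomialTerm-zero p zero = solve 2 (λ q u → con 1ℚ :* (q :* con 0ℚ) :* u := con 0ℚ) refl p (1/suc 0)
  negBinomialTerm-zero p (suc j) rewrite negBinomialTerm-zero p j =
    solve 2 (λ a u → con 0ℚ :* a :* u := con 0ℚ) refl (p * ℕ→ℚ (suc j)) (1/suc (suc j))

  negBinomialSum-zero≤1 : ∀ p N → negBinomialSum p 0 N ≤ 1ℚ
  negBinomialSum-zero≤1 p zero    = 0≤1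
  negBinomialSum-zero≤1 p (suc N) = ≤-reflexive (negBinomialSum-zero p N)
    where
    negBinomialSum-zero : ∀ p N → negBinomialSum p 0 (suc N) ≡ 1ℚ
    negBinomialSum-zero p zero = refl
    negBinomialSum-zero p (suc N) rewrite negBinomialSum-zero p N | negBinomialTerm-zero p N = refl

  negBinomialSum-bound : ∀ p M N → 0ℚ ≤ p → p ≤ 1ℚ → (1ℚ - p) ^ℚ M * negBinomialSum p M N ≤ 1ℚ
  negBinomialSum-bound p zero N 0≤p p≤1 = ≤-trans (≤-reflexive (*-identityˡ _)) (negBinomialSum-zero≤1 p N)
  negBinomialSum-bound p (suc M) N 0≤p p≤1 = begin
    ((1ℚ - p) ^ℚ M * (1ℚ - p)) * negBinomialSum p (suc M) N
      ≡⟨ *-assoc ((1ℚ - p) ^ℚ M) (1ℚ - p) _ ⟩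
    (1ℚ - p) ^ℚ M * ((1ℚ - p) * negBinomialSum p (suc M) N)
      ≤⟨ *-monoˡ-≤-0≤ (^ℚ-nonNeg M (1-p-nonNeg p≤1)) (negBinomialSum-step p M N 0≤p) ⟩
    (1ℚ - p) ^ℚ M * negBinomialSum p M (suc N)
      ≤⟨ negBinomialSum-bound p M (suc N) 0≤p p≤1 ⟩
    1ℚ ∎
    where open ≤-Reasoning

  1-p^M*expPartial≤1 : ∀ p M N → 0ℚ ≤ p → p ≤ 1ℚ → (1ℚ - p) ^ℚ M * expPartial (p * ℕ→ℚ M) N ≤ 1ℚ
  1-p^M*expPartial≤1 p M N 0≤p p≤1 =
    ≤-trans (*-monoˡ-≤-0≤ (^ℚ-nonNeg M (1-p-nonNeg p≤1)) (expPartial≤negBinomialSum M N 0≤p))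
            (negBinomialSum-bound p M N 0≤p p≤1)

module WeightedSums where
  open import Data.Nat using (zero; suc)
  open import Data.Fin as Fin using (Fin; zero; suc)
  open import Data.Bool using (if_then_else_)
  open import Data.Product using (Σ; _,_)
  open import Data.Rational
  open import Data.Rational.Properties
  open import Data.Rational.Solver using (module +-*-Solver)
  open +-*-Solver
  open import Relation.Nullary using (yes; no; does; contradiction)
  open import Relation.Binary.PropositionalEquality
  open RationalArithmetic

  δ : ∀ {K} → Fin K → Fin K → ℚ
  δ u v = if does (u Fin.≟ v) then 1ℚ else 0ℚ

  δ-nonNeg : ∀ {K} (u v : Fin K) → 0ℚ ≤ δ u v
  δ-nonNeg u v with u Fin.≟ v
  ... | yes _ = 0≤1
  ... | no  _ = ≤-refl

  δ-refl : ∀ {K} (u : Fin K) → δ u u ≡ 1ℚ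
  δ-refl u with u Fin.≟ u
  ... | yes _   = refl
  ... | no  u≢u = contradiction refl u≢u

  δ-suc : ∀ {K} (u v : Fin K) → δ (suc u) (suc v) ≡ δ u v
  δ-suc u v with u Fin.≟ v
  ... | yes _ = refl
  ... | no  _ = refl

  sum-mono-≤ : ∀ {K} {f g : Fin K → ℚ} → (∀ v → f v ≤ g v) → sum f ≤ sum g
  sum-mono-≤ {zero}  f≤g = ≤-refl
  sum-mono-≤ {suc K} f≤g = +-mono-≤ (f≤g zero) (sum-mono-≤ (λ v → f≤g (suc v)))

  sum-*-δ : ∀ {K} (w : Fin K → ℚ) i → ∑[ v < K ] (w v * δ v i) ≡ w i
  sum-*-δ w zero = begin
    w zero * 1ℚ + ∑[ v < _ ] (w (suc v) * 0ℚ) ≡⟨ cong (_+_ (w zero * 1ℚ)) (sum-zero (λ v → w (suc v))) ⟩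
    w zero * 1ℚ + 0ℚ                          ≡⟨ solve 1 (λ x → x :* con 1ℚ :+ con 0ℚ := x) refl (w zero) ⟩
    w zero                                    ∎
    where
    open ≡-Reasoning
    sum-zero : ∀ {K} (f : Fin K → ℚ) → ∑[ v < K ] (f v * 0ℚ) ≡ 0ℚ
    sum-zero {zero}  f = refl
    sum-zero {suc K} f rewrite *-zeroʳ (f zero) | sum-zero (λ v → f (suc v)) = refl
  sum-*-δ w (suc i) = begin
    w zero * 0ℚ + ∑[ v < _ ] (w (suc v) * δ (suc v) (suc i))
      ≡⟨ cong₂ _+_ (*-zeroʳ (w zero)) (sum-cong-≗ (λ v → cong (w (suc v) *_) (δ-suc v i))) ⟩
    0ℚ + ∑[ v < _ ] (w (suc v) * δ v i) ≡⟨ +-identityˡ _ ⟩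
    ∑[ v < _ ] (w (suc v) * δ v i)      ≡⟨ sum-*-δ (λ v → w (suc v)) i ⟩
    w (suc i)                           ∎
    where open ≡-Reasoning

  sum≡1⇒inhabited : ∀ {K} (w : Fin K → ℚ) → sum w ≡ 1ℚ → Fin K
  sum≡1⇒inhabited {zero}  w ()
  sum≡1⇒inhabited {suc K} w _ = zero

  sum-const : ∀ K y → ∑[ i < K ] y ≡ ℕ→ℚ K * y
  sum-const zero    y = sym (*-zeroˡ y)
  sum-const (suc K) y = begin
    y + ∑[ i < K ] y         ≡⟨ cong (_+_ y) (sum-const K y) ⟩
    y + ℕ→ℚ K * y            ≡⟨ solve 2 (λ y k → y :+ k :* y := (con 1ℚ :+ k) :* y) refl y (ℕ→ℚ K) ⟩
    (1ℚ + ℕ→ℚ K) * y         ≡⟨ cong (_* y) (ℕ→ℚ-+ 1 K) ⟨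
    ℕ→ℚ (suc K) * y          ∎
    where open ≡-Reasoning

  minimiser : ∀ {K} (g : Fin (suc K) → ℚ) → Σ (Fin (suc K)) λ v → ∀ u → g v ≤ g u
  minimiser {zero} g = zero , λ { zero → ≤-refl }
  minimiser {suc K} g with minimiser (λ v → g (suc v))
  ... | v , gv≤ with g zero ≤? g (suc v)
  ...   | yes g0≤gv = zero , λ { zero → ≤-refl ; (suc u) → ≤-trans g0≤gv (gv≤ u) }
  ...   | no  g0≰gv = suc v , λ { zero → <⇒≤ (≰⇒> g0≰gv) ; (suc u) → gv≤ u }

  ∃≤weighted-average : ∀ {K} (w g : Fin K → ℚ) → (∀ v → 0ℚ ≤ w v) → sum w ≡ 1ℚ →
                       Σ (Fin K) λ v → g v ≤ ∑[ u < K ] (w u * g u)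
  ∃≤weighted-average {zero}  w g _ ()
  ∃≤weighted-average {suc K} w g w≥0 ∑w≡1 with minimiser g
  ... | v , gv≤ = v , (begin
    g v                          ≡⟨ *-identityˡ (g v) ⟨
    1ℚ * g v                     ≡⟨ cong (_* g v) ∑w≡1 ⟨
    sum w * g v                  ≡⟨ *-distribʳ-sum (g v) w ⟩
    ∑[ u < suc K ] (w u * g v)   ≤⟨ sum-mono-≤ (λ u → *-monoˡ-≤-0≤ (w≥0 u) (gv≤ u)) ⟩
    ∑[ u < suc K ] (w u * g u)   ∎)
    where open ≤-Reasoning

-- A state (c , free) colours the variables in free independently at random with law w,
-- and every other variable x with c x.
module ConditionalExpectation
  {X : Set} (_≟_ : DecidableEquality X)
  {K : ℕ} (w : Fin K → ℚ) (w-nonNeg : ∀ v → 0ℚ ℚ.≤ w v) (∑w≡1 : sum w ≡ 1ℚ) where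

  open import Data.Nat using (zero)
  open import Data.Fin using (zero; suc)
  open import Data.Bool using (true; false; if_then_else_)
  open import Data.List as List using (List; []; _∷_; _++_; length; concat)
  open import Data.List.Relation.Unary.All using (All; []; _∷_)
  open import Data.List.Relation.Unary.Any using (here; there)
  open import Data.List.Relation.Unary.Unique.Propositional using (Unique; []; _∷_)
  open import Data.List.Relation.Unary.All.Properties using (All¬⇒¬Any)
  open import Data.List.Membership.Propositional using (_∈_; _∉_)
  open import Data.List.Membership.DecPropositional _≟_ using (_∈?_)
  open import Data.Product using (Σ; _×_; _,_; proj₁)
  open import Relation.Nullary using (Dec; yes; no; does; ¬_; contradiction)
  open import Data.Rational hiding (_≟_)
  open import Data.Rational.Properties hiding (_≟_)
  open import Data.Rational.Solver using (module +-*-Solver)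
  open +-*-Solver
  open import Relation.Binary.PropositionalEquality
  open import Function using (_∘_)
  open RationalArithmetic
  open WeightedSums

  Event : Set
  Event = List X × Fin K

  Occurs : (X → Fin K) → Event → Set
  Occurs c (xs , i) = All (λ x → c x ≡ i) xs

  _[_↦_] : (X → Fin K) → X → Fin K → X → Fin K
  (c [ x ↦ v ]) y = if does (y ≟ x) then v else c y

  colourProb : (X → Fin K) → List X → Fin K → X → ℚ
  colourProb c free i x = if does (x ∈? free) then w i else δ (c x) i

  eventProb : (X → Fin K) → List X → Event → ℚ
  eventProb c free ([]     , i) = 1ℚ
  eventProb c free (x ∷ xs , i) = colourProb c free i x * eventProb c free (xs , i)

  expectedOccurrences : (X → Fin K) → List X → List Event → ℚ
  expectedOccurrences c free []       = 0ℚ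
  expectedOccurrences c free (e ∷ es) = eventProb c free e + expectedOccurrences c free es

  colourProb-∈ : ∀ c {free} i {x} → x ∈ free → colourProb c free i x ≡ w i
  colourProb-∈ c {free} i {x} x∈free with x ∈? free
  ... | yes _      = refl
  ... | no  x∉free = contradiction x∈free x∉free

  colourProb-updated : ∀ c {free} i x v → x ∉ free → colourProb (c [ x ↦ v ]) free i x ≡ δ v i
  colourProb-updated c {free} i x v x∉free with x ∈? free | x ≟ x
  ... | yes x∈free | _        = contradiction x∈free x∉free
  ... | no  _      | yes _    = refl
  ... | no  _      | no  x≢x = contradiction refl x≢x

  colourProb-update-≢ : ∀ c free i x v {y} → y ≢ x →
                        colourProb (c [ x ↦ v ]) free i y ≡ colourProb c (x ∷ free) i y
  colourProb-update-≢ c free i x v {y} y≢x with y ≟ x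
  ... | yes y≡x = contradiction y≡x y≢x
  ... | no  _   = refl

  eventProb-update-∉ : ∀ c free x v {xs} i → x ∉ xs →
                       eventProb (c [ x ↦ v ]) free (xs , i) ≡ eventProb c (x ∷ free) (xs , i)
  eventProb-update-∉ c free x v {[]}     i x∉xs = refl
  eventProb-update-∉ c free x v {y ∷ xs} i x∉xs = cong₂ _*_
    (colourProb-update-≢ c free i x v (λ y≡x → x∉xs (here (sym y≡x))))
    (eventProb-update-∉ c free x v i (λ x∈xs → x∉xs (there x∈xs)))

  -- Distinctness of the variables of e is essential: a repeated x would be counted as two
  -- independent random choices.
  eventProb-expand : ∀ c free x (e : Event) → x ∉ free → Unique (proj₁ e) →
    eventProb c (x ∷ free) e ≡ ∑[ v < K ] (w v * eventProb (c [ x ↦ v ]) free e)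
  eventProb-expand-∷ : ∀ c free x y xs i → x ∉ free → y ∉ xs → Unique xs → Dec (y ≡ x) →
    eventProb c (x ∷ free) (y ∷ xs , i) ≡ ∑[ v < K ] (w v * eventProb (c [ x ↦ v ]) free (y ∷ xs , i))

  eventProb-expand c free x ([] , i) x∉free [] = begin
    1ℚ                      ≡⟨ *-identityʳ 1ℚ ⟨
    1ℚ * 1ℚ                 ≡⟨ cong (_* 1ℚ) ∑w≡1 ⟨
    sum w * 1ℚ              ≡⟨ *-distribʳ-sum 1ℚ w ⟩
    ∑[ v < K ] (w v * 1ℚ)   ∎
    where open ≡-Reasoning
  eventProb-expand c free x (y ∷ xs , i) x∉free (y∉xs ∷ xs-unique) =
    eventProb-expand-∷ c free x y xs i x∉free (All¬⇒¬Any y∉xs) xs-unique (y ≟ x)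

  eventProb-expand-∷ c free x .x xs i x∉free x∉xs _ (yes refl) = begin
    colourProb c (x ∷ free) i x * P
      ≡⟨ cong (_* P) (colourProb-∈ c {x ∷ free} i (here refl)) ⟩
    w i * P
      ≡⟨ cong (_* P) (sum-*-δ w i) ⟨
    ∑[ v < K ] (w v * δ v i) * P
      ≡⟨ *-distribʳ-sum P (λ v → w v * δ v i) ⟩
    ∑[ v < K ] (w v * δ v i * P)
      ≡⟨ sum-cong-≗ (λ v → trans (*-assoc (w v) _ P) (cong (w v *_) (sym (cong₂ _*_
           (colourProb-updated c i x v x∉free) (eventProb-update-∉ c free x v i x∉xs))))) ⟩
    ∑[ v < K ] (w v * eventProb (c [ x ↦ v ]) free (x ∷ xs , i)) ∎
    where
    open ≡-Reasoning
    P = eventProb c (x ∷ free) (xs , i)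
  eventProb-expand-∷ c free x y xs i x∉free _ xs-unique (no y≢x) = begin
    F * eventProb c (x ∷ free) (xs , i)
      ≡⟨ cong (F *_) (eventProb-expand c free x (xs , i) x∉free xs-unique) ⟩
    F * ∑[ v < K ] (w v * E v)
      ≡⟨ *-distribˡ-sum F (λ v → w v * E v) ⟩
    ∑[ v < K ] (F * (w v * E v))
      ≡⟨ sum-cong-≗ (λ v → trans (solve 3 (λ f a b → f :* (a :* b) := a :* (f :* b)) refl F (w v) (E v))
           (cong (λ z → w v * (z * E v)) (sym (colourProb-update-≢ c free i x v y≢x)))) ⟩
    ∑[ v < K ] (w v * (colourProb (c [ x ↦ v ]) free i y * E v)) ∎
    where
    open ≡-Reasoning
    F = colourProb c (x ∷ free) i y
    E = λ v → eventProb (c [ x ↦ v ]) free (xs , i)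

  expectedOccurrences-expand : ∀ c free x es → x ∉ free → All (Unique ∘ proj₁) es →
    expectedOccurrences c (x ∷ free) es ≡ ∑[ v < K ] (w v * expectedOccurrences (c [ x ↦ v ]) free es)
  expectedOccurrences-expand c free x [] x∉free [] = begin
    0ℚ                      ≡⟨ *-zeroʳ (sum w) ⟨
    sum w * 0ℚ              ≡⟨ *-distribʳ-sum 0ℚ w ⟩
    ∑[ v < K ] (w v * 0ℚ)   ∎
    where open ≡-Reasoning
  expectedOccurrences-expand c free x (e ∷ es) x∉free (e-unique ∷ es-unique) = begin
    eventProb c (x ∷ free) e + expectedOccurrences c (x ∷ free) es
      ≡⟨ cong₂ _+_ (eventProb-expand c free x e x∉free e-unique)
                   (expectedOccurrences-expand c free x es x∉free es-unique) ⟩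
    ∑[ v < K ] (w v * P v) + ∑[ v < K ] (w v * E v)
      ≡⟨ ∑-distrib-+ (λ v → w v * P v) (λ v → w v * E v) ⟨
    ∑[ v < K ] (w v * P v + w v * E v)
      ≡⟨ sum-cong-≗ (λ v → sym (*-distribˡ-+ (w v) (P v) (E v))) ⟩
    ∑[ v < K ] (w v * (P v + E v)) ∎
    where
    open ≡-Reasoning
    P = λ v → eventProb (c [ x ↦ v ]) free e
    E = λ v → expectedOccurrences (c [ x ↦ v ]) free es

  derandomise : ∀ free c es → Unique free → All (Unique ∘ proj₁) es →
                expectedOccurrences c free es < 1ℚ →
                Σ (X → Fin K) λ c′ → expectedOccurrences c′ [] es < 1ℚ
  derandomise []           c es _                       _         E<1 = c , E<1
  derandomise (x ∷ free) c es (x∉free ∷ free-unique) es-unique E<1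
    with ∃≤weighted-average w (λ v → expectedOccurrences (c [ x ↦ v ]) free es) w-nonNeg ∑w≡1
  ... | v , Ev≤E = derandomise free (c [ x ↦ v ]) es free-unique es-unique
    (≤-<-trans Ev≤E (subst (_< 1ℚ) (expectedOccurrences-expand c free x es (All¬⇒¬Any x∉free) es-unique) E<1))

  colourProb-nonNeg : ∀ c free i x → 0ℚ ≤ colourProb c free i x
  colourProb-nonNeg c free i x with does (x ∈? free)
  ... | true  = w-nonNeg i
  ... | false = δ-nonNeg (c x) i

  eventProb-nonNeg : ∀ c free e → 0ℚ ≤ eventProb c free e
  eventProb-nonNeg c free ([]     , i) = 0≤1
  eventProb-nonNeg c free (x ∷ xs , i) = *-nonNeg (colourProb-nonNeg c free i x) (eventProb-nonNeg c free (xs , i))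

  expectedOccurrences-nonNeg : ∀ c free es → 0ℚ ≤ expectedOccurrences c free es
  expectedOccurrences-nonNeg c free []       = ≤-refl
  expectedOccurrences-nonNeg c free (e ∷ es) =
    +-nonNeg (eventProb-nonNeg c free e) (expectedOccurrences-nonNeg c free es)

  eventProb≤expectedOccurrences : ∀ c free {e es} → e ∈ es → eventProb c free e ≤ expectedOccurrences c free es
  eventProb≤expectedOccurrences c free {e} {_ ∷ es} (here refl) =
    ≤-+-nonNeg (eventProb c free e) (expectedOccurrences-nonNeg c free es)
  eventProb≤expectedOccurrences c free {e} {e′ ∷ es} (there e∈es) = begin
    eventProb c free e                                    ≡⟨ +-identityˡ _ ⟨
    0ℚ + eventProb c free e                               ≤⟨ +-mono-≤ (eventProb-nonNeg c free e′)
                                                               (eventProb≤expectedOccurrences c free e∈es) ⟩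
    eventProb c free e′ + expectedOccurrences c free es   ∎
    where open ≤-Reasoning

  eventProb-occurs : ∀ c e → Occurs c e → eventProb c [] e ≡ 1ℚ
  eventProb-occurs c ([]     , i) []            = refl
  eventProb-occurs c (x ∷ xs , i) (cx≡i ∷ occ) rewrite cx≡i | δ-refl i | eventProb-occurs c (xs , i) occ = refl

  eventProb-free : ∀ c free xs i → All (_∈ free) xs → eventProb c free (xs , i) ≡ w i ^ℚ length xs
  eventProb-free c free []       i []              = refl
  eventProb-free c free (x ∷ xs) i (x∈free ∷ xs⊆free)
    rewrite colourProb-∈ c i x∈free | eventProb-free c free xs i xs⊆free = *-comm (w i) _

  expectedOccurrences-++ : ∀ c free es₁ es₂ →
    expectedOccurrences c free (es₁ ++ es₂) ≡ expectedOccurrences c free es₁ + expectedOccurrences c free es₂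
  expectedOccurrences-++ c free []        es₂ = sym (+-identityˡ _)
  expectedOccurrences-++ c free (e ∷ es₁) es₂ rewrite expectedOccurrences-++ c free es₁ es₂ =
    sym (+-assoc (eventProb c free e) _ _)

  expectedOccurrences-concat : ∀ c free {J} (ess : Fin J → List Event) →
    expectedOccurrences c free (concat (List.tabulate ess)) ≡ ∑[ j < J ] expectedOccurrences c free (ess j)
  expectedOccurrences-concat c free {zero}  ess = refl
  expectedOccurrences-concat c free {suc J} ess = begin
    expectedOccurrences c free (ess zero ++ concat (List.tabulate (ess ∘ suc)))
      ≡⟨ expectedOccurrences-++ c free (ess zero) _ ⟩
    expectedOccurrences c free (ess zero) + expectedOccurrences c free (concat (List.tabulate (ess ∘ suc)))
      ≡⟨ cong (_+_ (expectedOccurrences c free (ess zero))) (expectedOccurrences-concat c free (ess ∘ suc)) ⟩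
    expectedOccurrences c free (ess zero) + ∑[ j < J ] expectedOccurrences c free (ess (suc j)) ∎
    where open ≡-Reasoning

  expectedOccurrences-constant : ∀ c free es p → All (λ e → eventProb c free e ≡ p) es →
    expectedOccurrences c free es ≡ ℕ→ℚ (length es) * p
  expectedOccurrences-constant c free []       p []             = sym (*-zeroˡ p)
  expectedOccurrences-constant c free (e ∷ es) p (pe≡p ∷ pes≡p) = begin
    eventProb c free e + expectedOccurrences c free es
      ≡⟨ cong₂ _+_ pe≡p (expectedOccurrences-constant c free es p pes≡p) ⟩
    p + ℕ→ℚ (length es) * p
      ≡⟨ solve 2 (λ x n → x :+ n :* x := (con 1ℚ :+ n) :* x) refl p (ℕ→ℚ (length es)) ⟩
    (1ℚ + ℕ→ℚ (length es)) * p
      ≡⟨ cong (_* p) (ℕ→ℚ-+ 1 (length es)) ⟨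
    ℕ→ℚ (suc (length es)) * p ∎
    where open ≡-Reasoning

  colouring-avoiding-events : ∀ free es → Unique free → All (Unique ∘ proj₁) es →
    (∀ c → expectedOccurrences c free es < 1ℚ) → Σ (X → Fin K) λ c′ → ∀ {e} → e ∈ es → ¬ Occurs c′ e
  colouring-avoiding-events free es free-unique es-unique E<1
    with derandomise free (λ _ → sum≡1⇒inhabited w ∑w≡1) es free-unique es-unique (E<1 _)
  ... | c′ , E′<1 = c′ , λ {e} e∈es occ → <-irrefl refl (<-≤-trans E′<1 (begin
    1ℚ                                ≡⟨ eventProb-occurs c′ e occ ⟨
    eventProb c′ [] e                 ≤⟨ eventProb≤expectedOccurrences c′ [] e∈es ⟩
    expectedOccurrences c′ [] es      ∎))
    where open ≤-Reasoning

module FiniteEnumerations where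
  open import Data.Nat as ℕ using (ℕ; zero; suc)
  import Data.Nat.Properties as ℕ
  open import Data.Bool using (Bool; true; false)
  open import Data.Fin as Fin using (Fin; zero; suc)
  import Data.Fin.Properties as Fin
  open import Data.Fin.Subset using (Subset; _⊆_) renaming (_∈_ to _∈ₛ_)
  open import Data.Fin.Subset.Properties using (⊆-antisym) renaming (_∈?_ to _∈ₛ?_)
  open import Data.Vec using ([]; _∷_)
  import Data.Vec.Properties as Vec
  import Data.Vec.Functional as Vector
  open import Data.List using (List; []; _∷_; _++_; map; filter; length; allFin; cartesianProductWith)
  import Data.List.Properties as List
  open import Data.List.Membership.Propositional using (_∈_)
  open import Data.List.Membership.Propositional.Properties
    using (∈-++⁺ˡ; ∈-++⁺ʳ; ∈-map⁺; ∈-map⁻; ∈-allFin; ∈-cartesianProductWith⁺)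
  open import Data.List.Relation.Unary.Any using (here)
  open import Data.List.Relation.Unary.All using ([])
  open import Data.List.Relation.Unary.Unique.Propositional using (Unique; []; _∷_)
  import Data.List.Relation.Unary.Unique.Propositional.Properties as Unique
  open import Data.Product using (∃; _×_; _,_)
  open import Function using (_∘_)
  open import Function.Definitions using (Injective)
  open import Relation.Nullary using (Dec; yes; no; does; ¬_; contradiction)
  open import Relation.Nullary.Decidable using (dec-true; _×-dec_; _→-dec_)
  open import Relation.Binary.PropositionalEquality

  allSubsets-complete : ∀ n (S : Subset n) → S ∈ allSubsets n
  allSubsets-complete zero    []          = here refl
  allSubsets-complete (suc n) (true ∷ S)  = ∈-++⁺ˡ (∈-map⁺ (true ∷_) (allSubsets-complete n S))
  allSubsets-complete (suc n) (false ∷ S) =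
    ∈-++⁺ʳ (map (true ∷_) (allSubsets n)) (∈-map⁺ (false ∷_) (allSubsets-complete n S))

  allSubsets-unique : ∀ n → Unique (allSubsets n)
  allSubsets-unique zero    = [] ∷ []
  allSubsets-unique (suc n) =
    Unique.++⁺ (Unique.map⁺ Vec.∷-injectiveʳ (allSubsets-unique n))
               (Unique.map⁺ Vec.∷-injectiveʳ (allSubsets-unique n))
               disjoint
    where
    disjoint : ∀ {S} → ¬ (S ∈ map (true ∷_) (allSubsets n) × S ∈ map (false ∷_) (allSubsets n))
    disjoint (S∈₁ , S∈₂) with ∈-map⁻ (true ∷_) S∈₁ | ∈-map⁻ (false ∷_) S∈₂
    ... | _ , _ , refl | _ , _ , ()

  allFunctions : ∀ a n → List (Fin a → Fin n)
  allFunctions zero    n = Vector.[] ∷ []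
  allFunctions (suc a) n = cartesianProductWith Vector._∷_ (allFin n) (allFunctions a n)

  allFunctions-complete : ∀ a n (f : Fin a → Fin n) → ∃ λ g → g ∈ allFunctions a n × (∀ x → g x ≡ f x)
  allFunctions-complete zero    n f = Vector.[] , here refl , λ ()
  allFunctions-complete (suc a) n f with allFunctions-complete a n (f ∘ suc)
  ... | g , g∈ , g≗f∘suc =
    f zero Vector.∷ g , ∈-cartesianProductWith⁺ Vector._∷_ (∈-allFin (f zero)) g∈ ,
    λ { zero → refl ; (suc x) → g≗f∘suc x }

  length-cartesianProductWith : ∀ {A B C : Set} (f : A → B → C) xs ys →
    length (cartesianProductWith f xs ys) ≡ length xs ℕ.* length ys
  length-cartesianProductWith f []       ys = refl
  length-cartesianProductWith f (x ∷ xs) ys = begin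
    length (map (f x) ys ++ cartesianProductWith f xs ys)
      ≡⟨ List.length-++ (map (f x) ys) ⟩
    length (map (f x) ys) ℕ.+ length (cartesianProductWith f xs ys)
      ≡⟨ cong₂ ℕ._+_ (List.length-map (f x) ys) (length-cartesianProductWith f xs ys) ⟩
    length ys ℕ.+ length xs ℕ.* length ys ∎
    where open ≡-Reasoning

  length-allFunctions : ∀ a n → length (allFunctions a n) ≡ n ℕ.^ a
  length-allFunctions zero    n = refl
  length-allFunctions (suc a) n = begin
    length (cartesianProductWith Vector._∷_ (allFin n) (allFunctions a n))
      ≡⟨ length-cartesianProductWith Vector._∷_ (allFin n) (allFunctions a n) ⟩
    length (allFin n) ℕ.* length (allFunctions a n)
      ≡⟨ cong₂ ℕ._*_ (List.length-tabulate {n = n} (λ x → x)) (length-allFunctions a n) ⟩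
    n ℕ.* n ℕ.^ a ∎
    where open ≡-Reasoning

  injective? : ∀ {a n} (f : Fin a → Fin n) → Dec (∀ x y → f x ≡ f y → x ≡ y)
  injective? f = Fin.all? (λ x → Fin.all? (λ y → (f x Fin.≟ f y) →-dec (x Fin.≟ y)))

  injections : ∀ a n → List (Fin a → Fin n)
  injections a n = filter injective? (allFunctions a n)

  length-injections : ∀ a n → length (injections a n) ℕ.≤ n ℕ.^ a
  length-injections a n =
    ℕ.≤-trans (List.length-filter injective? (allFunctions a n)) (ℕ.≤-reflexive (length-allFunctions a n))

  module _ {p q : ℕ} (f : Fin p → Fin q) where

    imageWitness? : (S : Subset p) (y : Fin q) → Dec (∃ λ x → x ∈ₛ S × f x ≡ y)
    imageWitness? S y = Fin.any? (λ x → (x ∈ₛ? S) ×-dec (f x Fin.≟ y))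

    lookup-image : ∀ S y → Data.Vec.lookup (image f S) y ≡ does (imageWitness? S y)
    lookup-image S y = Vec.lookup∘tabulate _ y

    image-∈⁺ : ∀ {S x} → x ∈ₛ S → f x ∈ₛ image f S
    image-∈⁺ {S} {x} x∈S = Vec.lookup⇒[]= (f x) (image f S)
      (trans (lookup-image S (f x)) (dec-true (imageWitness? S (f x)) (x , x∈S , refl)))

    image-∈⁻ : ∀ {S y} → y ∈ₛ image f S → ∃ λ x → x ∈ₛ S × f x ≡ y
    image-∈⁻ {S} {y} y∈fS with imageWitness? S y | lookup-image S y
    ... | yes witness | _       = witness
    ... | no  _       | lookup≡ = contradiction (trans (sym lookup≡) (Vec.[]=⇒lookup y∈fS)) λ ()

    image-injective : Injective _≡_ _≡_ f → Injective _≡_ _≡_ (image f)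
    image-injective f-inj {C} {D} fC≡fD = ⊆-antisym (C⊆D fC≡fD) (C⊆D (sym fC≡fD))
      where
      C⊆D : ∀ {C D} → image f C ≡ image f D → C ⊆ D
      C⊆D {C} {D} eq x∈C with image-∈⁻ {D} (subst (f _ ∈ₛ_) eq (image-∈⁺ x∈C))
      ... | x′ , x′∈D , fx′≡fx = subst (_∈ₛ D) (f-inj fx′≡fx) x′∈D

  image-cong : ∀ {p q} {f g : Fin p → Fin q} → (∀ x → f x ≡ g x) → ∀ S → image f S ≡ image g S
  image-cong {f = f} {g} f≗g S = ⊆-antisym (fS⊆gS f≗g) (fS⊆gS (sym ∘ f≗g))
    where
    fS⊆gS : ∀ {f g : Fin _ → Fin _} → (∀ x → f x ≡ g x) → image f S ⊆ image g S
    fS⊆gS {f} {g} f≗g y∈fS with image-∈⁻ f y∈fS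
    ... | x , x∈S , refl = subst (_∈ₛ image g S) (sym (f≗g x)) (image-∈⁺ g x∈S)

module MonochromaticCopies
  (t : ℕ) (Q : FinPoset)
  {K : ℕ} (w : Fin K → ℚ) (w-nonNeg : ∀ v → 0ℚ ℚ.≤ w v) (∑w≡1 : sum w ≡ 1ℚ) where

  import Data.Nat as ℕ
  import Data.Bool as Bool
  open import Data.Fin.Subset using (Subset)
  import Data.Vec.Properties as Vec
  open import Data.List as List using (List; map; filter; length; concat)
  import Data.List.Properties as List
  open import Data.List.Membership.Propositional using (_∈_)
  open import Data.List.Membership.Propositional.Properties
    using (∈-map⁺; ∈-filter⁺; ∈-filter⁻; ∈-concat⁺′; ∈-tabulate⁺)
  open import Data.List.Relation.Unary.All as All using (All)
  import Data.List.Relation.Unary.All.Properties as All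
  open import Data.List.Relation.Unary.Unique.Propositional using (Unique)
  import Data.List.Relation.Unary.Unique.Propositional.Properties as Unique
  open import Data.Product using (Σ; ∃; _×_; _,_; proj₁; proj₂; map₂)
  open import Function using (_∘_)
  open import Relation.Nullary using (¬_)
  open import Data.Rational hiding (_≟_)
  open import Data.Rational.Properties hiding (_≟_)
  open import Relation.Binary.PropositionalEquality
  open RationalArithmetic
  open WeightedSums
  open FiniteEnumerations
  open ConditionalExpectation {X = Subset (size Q)} (Vec.≡-dec Bool._≟_) w w-nonNeg ∑w≡1

  chains : (P : FinPoset) → List (Subset (size P))
  chains P = filter (isChain? P t) (allSubsets (size P))

  copyEvent : (P : FinPoset) → (Fin (size P) → Fin (size Q)) → Fin K → Event
  copyEvent P g i = map (image g) (chains P) , i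

  copyEvents : FinPoset → Fin K → List Event
  copyEvents P i = map (λ g → copyEvent P g i) (injections (size P) (size Q))

  copyEvents-unique : ∀ P i → All (Unique ∘ proj₁) (copyEvents P i)
  copyEvents-unique P i = All.map⁺ (All.tabulate λ g∈ →
    Unique.map⁺ (image-injective _ (injective g∈)) (Unique.filter⁺ (isChain? P t) (allSubsets-unique (size P))))
    where
    injective : ∀ {g} → g ∈ injections (size P) (size Q) → ∀ {x y} → g x ≡ g y → x ≡ y
    injective g∈ {x} {y} = proj₂ (∈-filter⁻ injective? {xs = allFunctions (size P) (size Q)} g∈) x y

  monoCopy⇒occurs : ∀ P c i → MonoCopy P Q t c i → ∃ λ e → e ∈ copyEvents P i × Occurs c e
  monoCopy⇒occurs P c i (f , (f-injective , _) , f-mono) with allFunctions-complete (size P) (size Q) f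
  ... | g , g∈all , g≗f = copyEvent P g i , ∈-map⁺ _ (∈-filter⁺ injective? g∈all g-injective) ,
                          All.map⁺ (All.tabulate chain-coloured)
    where
    g-injective : ∀ x y → g x ≡ g y → x ≡ y
    g-injective x y gx≡gy = f-injective (trans (sym (g≗f x)) (trans gx≡gy (g≗f y)))
    chain-coloured : ∀ {C} → C ∈ chains P → c (image g C) ≡ i
    chain-coloured {C} C∈ = trans (cong c (image-cong g≗f C)) (f-mono C (proj₂ (∈-filter⁻ (isChain? P t) {xs = allSubsets (size P)} C∈)))

  expectedOccurrences-copyEvents : ∀ c P i →
    expectedOccurrences c (allSubsets (size Q)) (copyEvents P i) ≤ ℕ→ℚ (size Q) ^ℚ size P * w i ^ℚ numChains P t
  expectedOccurrences-copyEvents c P i = begin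
    expectedOccurrences c all (copyEvents P i)
      ≡⟨ expectedOccurrences-constant c all (copyEvents P i) wᵐ (All.map⁺ (All.tabulate λ _ → copyEventProb _)) ⟩
    ℕ→ℚ (length (copyEvents P i)) * wᵐ
      ≡⟨ cong (λ l → ℕ→ℚ l * wᵐ) (List.length-map _ (injections (size P) (size Q))) ⟩
    ℕ→ℚ (length (injections (size P) (size Q))) * wᵐ
      ≤⟨ *-monoʳ-≤-0≤ (^ℚ-nonNeg (numChains P t) (w-nonNeg i)) (ℕ→ℚ-mono-≤ (length-injections (size P) (size Q))) ⟩
    ℕ→ℚ (size Q ℕ.^ size P) * wᵐ
      ≡⟨ cong (_* wᵐ) (ℕ→ℚ-^ (size Q) (size P)) ⟩
    ℕ→ℚ (size Q) ^ℚ size P * wᵐ ∎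
    where
    open ≤-Reasoning
    all = allSubsets (size Q)
    wᵐ = w i ^ℚ numChains P t
    copyEventProb : ∀ g → eventProb c all (copyEvent P g i) ≡ wᵐ
    copyEventProb g = trans (eventProb-free c all (map (image g) (chains P)) i (All.tabulate λ {S} _ → allSubsets-complete (size Q) S))
                            (cong (w i ^ℚ_) (List.length-map (image g) (chains P)))

  allCopyEvents : (Fin K → FinPoset) → List Event
  allCopyEvents Ps = concat (List.tabulate λ i → copyEvents (Ps i) i)

  expectedOccurrences-allCopyEvents : ∀ c Ps →
    expectedOccurrences c (allSubsets (size Q)) (allCopyEvents Ps)
      ≤ ∑[ i < K ] (ℕ→ℚ (size Q) ^ℚ size (Ps i) * w i ^ℚ numChains (Ps i) t)
  expectedOccurrences-allCopyEvents c Ps = begin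
    expectedOccurrences c (allSubsets (size Q)) (allCopyEvents Ps)
      ≡⟨ expectedOccurrences-concat c (allSubsets (size Q)) (λ i → copyEvents (Ps i) i) ⟩
    ∑[ i < K ] expectedOccurrences c (allSubsets (size Q)) (copyEvents (Ps i) i)
      ≤⟨ sum-mono-≤ (λ i → expectedOccurrences-copyEvents c (Ps i) i) ⟩
    ∑[ i < K ] (ℕ→ℚ (size Q) ^ℚ size (Ps i) * w i ^ℚ numChains (Ps i) t) ∎
    where open ≤-Reasoning

  avoids-allCopyEvents⇒no-monoCopy : ∀ Ps {c} → (∀ {e} → e ∈ allCopyEvents Ps → ¬ Occurs c e) →
                                      ∀ i → ¬ MonoCopy (Ps i) Q t c i
  avoids-allCopyEvents⇒no-monoCopy Ps {c} avoids i mono with monoCopy⇒occurs (Ps i) c i mono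
  ... | e , e∈ , occurs = avoids (∈-concat⁺′ e∈ (∈-tabulate⁺ i)) occurs

  colouring-without-monochromatic-copies : (Ps : Fin K → FinPoset) →
    ∑[ i < K ] (ℕ→ℚ (size Q) ^ℚ size (Ps i) * w i ^ℚ numChains (Ps i) t) < 1ℚ →
    Σ (Coloring Q K) λ c → ∀ i → ¬ MonoCopy (Ps i) Q t c i
  colouring-without-monochromatic-copies Ps bound<1 = map₂ (avoids-allCopyEvents⇒no-monoCopy Ps)
    (colouring-avoiding-events (allSubsets (size Q)) (allCopyEvents Ps) (allSubsets-unique (size Q))
      (All.concat⁺ (All.tabulate⁺ λ i → copyEvents-unique (Ps i) i))
      (λ c → ≤-<-trans (expectedOccurrences-allCopyEvents c Ps) bound<1))

module Estimates where
  open import Data.Nat as ℕ using (ℕ; suc)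
  import Data.Nat.Properties as ℕ
  import Data.Nat.DivMod as ℕ
  open import Data.Integer using (+_)
  open import Data.Product using (Σ; _×_; _,_)
  open import Relation.Nullary using (yes; no; contradiction)
  open import Data.Rational
  open import Data.Rational.Properties
  open import Data.Rational.Solver using (module +-*-Solver)
  open +-*-Solver
  open import Relation.Binary.PropositionalEquality
  open RationalArithmetic
  open ExponentialSeries

  ½≤q : ∀ n {q} N → 2 ℕ.≤ n → 0ℚ ≤ q → ℕ→ℚ n < expPartial q N → ½ ≤ q
  ½≤q n {q} N 2≤n 0≤q n<eq with q ≤? ½
  ... | yes q≤½ = contradiction (<-≤-trans n<eq (≤-trans (expPartial≤2 N 0≤q q≤½) (ℕ→ℚ-mono-≤ 2≤n))) (<-irrefl refl)
  ... | no  q≰½ = <⇒≤ (≰⇒> q≰½)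

  n*[1-p]^M≤1 : ∀ n {q p} N M → 0ℚ ≤ p → p ≤ 1ℚ → 0ℚ ≤ q → ℕ→ℚ n < expPartial q N → q ≤ p * ℕ→ℚ M →
                ℕ→ℚ n * (1ℚ - p) ^ℚ M ≤ 1ℚ
  n*[1-p]^M≤1 n {q} {p} N M 0≤p p≤1 0≤q n<eq q≤pM = begin
    ℕ→ℚ n * y                     ≤⟨ *-monoʳ-≤-0≤ 0≤y (<⇒≤ n<eq) ⟩
    expPartial q N * y            ≤⟨ *-monoʳ-≤-0≤ 0≤y (expPartial-monoˡ-≤ N 0≤q q≤pM) ⟩
    expPartial (p * ℕ→ℚ M) N * y  ≡⟨ *-comm _ y ⟩
    y * expPartial (p * ℕ→ℚ M) N  ≤⟨ 1-p^M*expPartial≤1 p M N 0≤p p≤1 ⟩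
    1ℚ                            ∎
    where
    open ≤-Reasoning
    y = (1ℚ - p) ^ℚ M
    0≤y = ^ℚ-nonNeg M (1-p-nonNeg p≤1)

  2*n^k*[1-p]^l≤1 : ∀ n {p} k M l → 0ℚ ≤ p → p ≤ 1ℚ → 2 ℕ.≤ n → suc k ℕ.* M ℕ.≤ l →
                    ℕ→ℚ n * (1ℚ - p) ^ℚ M ≤ 1ℚ → ℕ→ℚ 2 * (ℕ→ℚ n ^ℚ k * (1ℚ - p) ^ℚ l) ≤ 1ℚ
  2*n^k*[1-p]^l≤1 n {p} k M l 0≤p p≤1 2≤n [1+k]M≤l ny≤1 = begin
    ℕ→ℚ 2 * (ℕ→ℚ n ^ℚ k * (1ℚ - p) ^ℚ l)
      ≤⟨ *-monoʳ-≤-0≤ (*-nonNeg (^ℚ-nonNeg k 0≤n) (^ℚ-nonNeg l 0≤1-p)) (ℕ→ℚ-mono-≤ 2≤n) ⟩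
    ℕ→ℚ n * (ℕ→ℚ n ^ℚ k * (1ℚ - p) ^ℚ l)
      ≤⟨ *-monoˡ-≤-0≤ 0≤n (*-monoˡ-≤-0≤ (^ℚ-nonNeg k 0≤n) (^ℚ-antimonoʳ-≤ 0≤1-p (1-p≤1 0≤p) [1+k]M≤l)) ⟩
    ℕ→ℚ n * (ℕ→ℚ n ^ℚ k * (1ℚ - p) ^ℚ (suc k ℕ.* M))
      ≡⟨ cong (λ z → ℕ→ℚ n * (ℕ→ℚ n ^ℚ k * z)) (^ℚ-assocʳ (1ℚ - p) M (suc k)) ⟨
    ℕ→ℚ n * (ℕ→ℚ n ^ℚ k * (y ^ℚ k * y))
      ≡⟨ solve 4 (λ m a b c → m :* (a :* (b :* c)) := (a :* b) :* (m :* c)) refl (ℕ→ℚ n) (ℕ→ℚ n ^ℚ k) (y ^ℚ k) y ⟩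
    ℕ→ℚ n ^ℚ k * y ^ℚ k * (ℕ→ℚ n * y)
      ≡⟨ cong (_* (ℕ→ℚ n * y)) (^ℚ-distribʳ-* (ℕ→ℚ n) y k) ⟨
    (ℕ→ℚ n * y) ^ℚ suc k
      ≤⟨ ^ℚ-≤1 (suc k) (*-nonNeg 0≤n (^ℚ-nonNeg M 0≤1-p)) ny≤1 ⟩
    1ℚ ∎
    where
    open ≤-Reasoning
    y = (1ℚ - p) ^ℚ M
    0≤n = ℕ→ℚ-nonNeg n
    0≤1-p = 1-p-nonNeg p≤1

  m≤[m/n]*n+[n∸1] : ∀ m k → m ℕ.≤ (m ℕ./ suc k) ℕ.* suc k ℕ.+ k
  m≤[m/n]*n+[n∸1] m k = begin
    m                                         ≡⟨ ℕ.m≡m%n+[m/n]*n m (suc k) ⟩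
    m ℕ.% suc k ℕ.+ (m ℕ./ suc k) ℕ.* suc k   ≤⟨ ℕ.+-monoˡ-≤ _ (ℕ.s≤s⁻¹ (ℕ.m%n<n m (suc k))) ⟩
    k ℕ.+ (m ℕ./ suc k) ℕ.* suc k             ≡⟨ ℕ.+-comm k _ ⟩
    (m ℕ./ suc k) ℕ.* suc k ℕ.+ k             ∎
    where open ℕ.≤-Reasoning

  -- With l = M (k + 1) + (l mod (k + 1)), the remainder costs at most k, which 2q ≥ 1 absorbs.
  q≤p*[l/1+k] : ∀ {q p} k l → ½ ≤ q → 0ℚ ≤ p → p ≤ 1ℚ → ℕ→ℚ 3 * q * ℕ→ℚ (2 ℕ.+ k) ≤ p * ℕ→ℚ l →
                q ≤ p * ℕ→ℚ (l ℕ./ suc k)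
  q≤p*[l/1+k] {q} {p} k l ½≤q 0≤p p≤1 3q[2+k]≤pl =
    *-cancelʳ-≤-pos (ℕ→ℚ (suc k)) {{positive (ℕ→ℚ-pos {suc k} (ℕ.s≤s ℕ.z≤n))}} (+-cancelʳ-≤ x (begin
      q * ℕ→ℚ (suc k) + x                  ≡⟨ cong (λ z → q * z + x) (ℕ→ℚ-+ 1 k) ⟩
      q * (1ℚ + x) + x                     ≤⟨ +-monoʳ-≤ (q * (1ℚ + x)) x≤2qx ⟩
      q * (1ℚ + x) + ℕ→ℚ 2 * q * x         ≤⟨ ≤-+-nonNeg _ (*-nonNeg (ℕ→ℚ-nonNeg 5) 0≤q) ⟩
      q * (1ℚ + x) + ℕ→ℚ 2 * q * x + ℕ→ℚ 5 * q
        ≡⟨ solve 2 (λ q x → q :* (con 1ℚ :+ x) :+ con (ℕ→ℚ 2) :* q :* x :+ con (ℕ→ℚ 5) :* q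
                          := con (ℕ→ℚ 3) :* q :* (con (ℕ→ℚ 2) :+ x)) refl q x ⟩
      ℕ→ℚ 3 * q * (ℕ→ℚ 2 + x)              ≡⟨ cong (ℕ→ℚ 3 * q *_) (ℕ→ℚ-+ 2 k) ⟨
      ℕ→ℚ 3 * q * ℕ→ℚ (2 ℕ.+ k)            ≤⟨ 3q[2+k]≤pl ⟩
      p * ℕ→ℚ l                            ≤⟨ *-monoˡ-≤-0≤ 0≤p (ℕ→ℚ-mono-≤ l≤ML+k) ⟩
      p * ℕ→ℚ (M ℕ.* suc k ℕ.+ k)          ≡⟨ cong (p *_) (trans (ℕ→ℚ-+ (M ℕ.* suc k) k) (cong (_+ x) (ℕ→ℚ-* M (suc k)))) ⟩
      p * (ℕ→ℚ M * ℕ→ℚ (suc k) + x)        ≡⟨ *-distribˡ-+ p _ x ⟩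
      p * (ℕ→ℚ M * ℕ→ℚ (suc k)) + p * x    ≤⟨ +-mono-≤ (≤-reflexive (sym (*-assoc p _ _))) px≤x ⟩
      p * ℕ→ℚ M * ℕ→ℚ (suc k) + x          ∎))
    where
    open ≤-Reasoning
    M = l ℕ./ suc k
    x = ℕ→ℚ k
    0≤q = ≤-trans (nonNegative⁻¹ ½) ½≤q
    x≤2qx : x ≤ ℕ→ℚ 2 * q * x
    x≤2qx = ≤-trans (≤-reflexive (sym (*-identityˡ x)))
                    (*-monoʳ-≤-0≤ (ℕ→ℚ-nonNeg k) (≤-trans (≤-reflexive refl) (*-monoˡ-≤-0≤ (ℕ→ℚ-nonNeg 2) ½≤q)))
    px≤x : p * x ≤ x
    px≤x = ≤-trans (*-monoʳ-≤-0≤ (ℕ→ℚ-nonNeg k) p≤1) (≤-reflexive (*-identityˡ x))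
    l≤ML+k = m≤[m/n]*n+[n∸1] l k

  C₀ : ℕ → ℕ → ℚ
  C₀ k m = + 1 / suc (2 ℕ.* suc k ℕ.* 3 ℕ.^ m)

  C₀-pos : ∀ k m → 0ℚ < C₀ k m
  C₀-pos k m = positive⁻¹ (C₀ k m) {{normalize-pos 1 (suc (2 ℕ.* suc k ℕ.* 3 ℕ.^ m))}}

  *C₀≤1 : ∀ k m {a} → a ℕ.≤ 2 ℕ.* suc k ℕ.* 3 ℕ.^ m → ℕ→ℚ a * C₀ k m ≤ 1ℚ
  *C₀≤1 k m {a} a≤B = begin
    ℕ→ℚ a * C₀ k m        ≤⟨ *-monoʳ-≤-0≤ (<⇒≤ (C₀-pos k m)) (ℕ→ℚ-mono-≤ (ℕ.≤-trans a≤B (ℕ.n≤1+n B))) ⟩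
    ℕ→ℚ (suc B) * C₀ k m  ≡⟨ *-comm _ (C₀ k m) ⟩
    C₀ k m * ℕ→ℚ (suc B)  ≡⟨ /-*-cancel 1 B ⟩
    1ℚ                    ∎
    where
    open ≤-Reasoning
    B = 2 ℕ.* suc k ℕ.* 3 ℕ.^ m

  n^s*p^m<3^m*C : ∀ n {q r p C} s m → 0ℚ < r → p * r ≡ ℕ→ℚ 3 * q →
                  q ^ℚ m * ℕ→ℚ n ^ℚ s < C * r ^ℚ m → ℕ→ℚ n ^ℚ s * p ^ℚ m < ℕ→ℚ 3 ^ℚ m * C
  n^s*p^m<3^m*C n {q} {r} {p} {C} s m 0<r pr≡3q small =
    *-cancelʳ-<-nonNeg (r ^ℚ m) {{nonNegative (^ℚ-nonNeg m (<⇒≤ 0<r))}} (begin-strict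
      ℕ→ℚ n ^ℚ s * p ^ℚ m * r ^ℚ m         ≡⟨ *-assoc (ℕ→ℚ n ^ℚ s) _ _ ⟩
      ℕ→ℚ n ^ℚ s * (p ^ℚ m * r ^ℚ m)       ≡⟨ cong (ℕ→ℚ n ^ℚ s *_) (^ℚ-distribʳ-* p r m) ⟨
      ℕ→ℚ n ^ℚ s * (p * r) ^ℚ m            ≡⟨ cong (λ z → ℕ→ℚ n ^ℚ s * z ^ℚ m) pr≡3q ⟩
      ℕ→ℚ n ^ℚ s * (ℕ→ℚ 3 * q) ^ℚ m        ≡⟨ cong (ℕ→ℚ n ^ℚ s *_) (^ℚ-distribʳ-* (ℕ→ℚ 3) q m) ⟩
      ℕ→ℚ n ^ℚ s * (ℕ→ℚ 3 ^ℚ m * q ^ℚ m)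
        ≡⟨ solve 3 (λ a b c → a :* (b :* c) := b :* (c :* a)) refl (ℕ→ℚ n ^ℚ s) (ℕ→ℚ 3 ^ℚ m) (q ^ℚ m) ⟩
      ℕ→ℚ 3 ^ℚ m * (q ^ℚ m * ℕ→ℚ n ^ℚ s)   <⟨ *-monoˡ-<-0< 0<3^m small ⟩
      ℕ→ℚ 3 ^ℚ m * (C * r ^ℚ m)            ≡⟨ *-assoc (ℕ→ℚ 3 ^ℚ m) C _ ⟨
      ℕ→ℚ 3 ^ℚ m * C * r ^ℚ m              ∎)
    where
    open ≤-Reasoning
    0<3^m = <-≤-trans 0<1 (^ℚ-≥1 m (ℕ→ℚ-mono-≤ {1} {3} (ℕ.s≤s ℕ.z≤n)))

  n^s*p^m<1⇒p≤1 : ∀ {p} n s m → 1 ℕ.≤ n → ℕ→ℚ n ^ℚ s * p ^ℚ m < 1ℚ → p ≤ 1ℚ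
  n^s*p^m<1⇒p≤1 {p} n s m 1≤n n^s*p^m<1 with p ≤? 1ℚ
  ... | yes p≤1 = p≤1
  ... | no  p≰1 = contradiction (<-≤-trans n^s*p^m<1 (begin
    1ℚ                         ≡⟨ *-identityʳ 1ℚ ⟨
    1ℚ * 1ℚ                    ≤⟨ *-mono-≤-0≤ 0≤1 0≤1 (^ℚ-≥1 s (ℕ→ℚ-mono-≤ 1≤n)) (^ℚ-≥1 m (<⇒≤ (≰⇒> p≰1))) ⟩
    ℕ→ℚ n ^ℚ s * p ^ℚ m        ∎)) (<-irrefl refl)
    where open ≤-Reasoning

  2*[1+k]*Y<1 : ∀ k m {Y} → Y < ℕ→ℚ 3 ^ℚ m * C₀ k m → ℕ→ℚ 2 * (ℕ→ℚ (suc k) * Y) < 1ℚ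
  2*[1+k]*Y<1 k m {Y} Y<3^mC₀ = begin-strict
    ℕ→ℚ 2 * (ℕ→ℚ (suc k) * Y)                     ≡⟨ *-assoc (ℕ→ℚ 2) (ℕ→ℚ (suc k)) Y ⟨
    ℕ→ℚ 2 * ℕ→ℚ (suc k) * Y                       <⟨ *-monoˡ-<-0< 0<2[1+k] Y<3^mC₀ ⟩
    ℕ→ℚ 2 * ℕ→ℚ (suc k) * (ℕ→ℚ 3 ^ℚ m * C₀ k m)   ≡⟨ *-assoc (ℕ→ℚ 2 * ℕ→ℚ (suc k)) (ℕ→ℚ 3 ^ℚ m) (C₀ k m) ⟨
    ℕ→ℚ 2 * ℕ→ℚ (suc k) * ℕ→ℚ 3 ^ℚ m * C₀ k m     ≡⟨ cong (_* C₀ k m) B≡2[1+k]3^m ⟨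
    ℕ→ℚ (2 ℕ.* suc k ℕ.* 3 ℕ.^ m) * C₀ k m        ≤⟨ *C₀≤1 k m ℕ.≤-refl ⟩
    1ℚ                                            ∎
    where
    open ≤-Reasoning
    0<2[1+k] = subst (0ℚ <_) (ℕ→ℚ-* 2 (suc k)) (ℕ→ℚ-pos {2 ℕ.* suc k} (ℕ.s≤s ℕ.z≤n))
    B≡2[1+k]3^m : ℕ→ℚ (2 ℕ.* suc k ℕ.* 3 ℕ.^ m) ≡ ℕ→ℚ 2 * ℕ→ℚ (suc k) * ℕ→ℚ 3 ^ℚ m
    B≡2[1+k]3^m = trans (ℕ→ℚ-* (2 ℕ.* suc k) (3 ℕ.^ m)) (cong₂ _*_ (ℕ→ℚ-* 2 (suc k)) (ℕ→ℚ-^ 3 m))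

  3^m*C₀≤1 : ∀ k m → ℕ→ℚ 3 ^ℚ m * C₀ k m ≤ 1ℚ
  3^m*C₀≤1 k m = subst (λ z → z * C₀ k m ≤ 1ℚ) (ℕ→ℚ-^ 3 m) (*C₀≤1 k m (ℕ.m≤n*m (3 ℕ.^ m) (2 ℕ.* suc k)))

  -- Since ln n < q ≤ p⌊l/(k+1)⌋, we get n (1 - p)^⌊l/(k+1)⌋ ≤ 1.
  lastColour-bound : ∀ n {q p} k l X N → k ℕ.≤ X → 2 ℕ.≤ n → 0ℚ ≤ q → ℕ→ℚ n < expPartial q N →
    0ℚ ≤ p → p ≤ 1ℚ → ℕ→ℚ 3 * q * ℕ→ℚ (2 ℕ.+ X) ≤ p * ℕ→ℚ l →
    ℕ→ℚ 2 * (ℕ→ℚ n ^ℚ k * (1ℚ - p) ^ℚ l) ≤ 1ℚ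
  lastColour-bound n {q} {p} k l X N k≤X 2≤n 0≤q n<eq 0≤p p≤1 3q[2+X]≤pl =
    2*n^k*[1-p]^l≤1 n k M l 0≤p p≤1 2≤n [1+k]M≤l
      (n*[1-p]^M≤1 n N M 0≤p p≤1 0≤q n<eq
        (q≤p*[l/1+k] k l (½≤q n N 2≤n 0≤q n<eq) 0≤p p≤1
          (≤-trans (*-monoˡ-≤-0≤ (*-nonNeg (ℕ→ℚ-nonNeg 3) 0≤q) (ℕ→ℚ-mono-≤ (ℕ.+-monoʳ-≤ 2 k≤X))) 3q[2+X]≤pl)))
    where
    M = l ℕ./ suc k
    [1+k]M≤l = ℕ.≤-trans (ℕ.≤-reflexive (ℕ.*-comm (suc k) M)) (ℕ.m/n*n≤m l (suc k))

  +<1-from-halves : ∀ {a b} → ℕ→ℚ 2 * a < 1ℚ → ℕ→ℚ 2 * b ≤ 1ℚ → a + b < 1ℚ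
  +<1-from-halves {a} {b} 2a<1 2b≤1 = *-cancelˡ-<-nonNeg (ℕ→ℚ 2) {{nonNegative (ℕ→ℚ-nonNeg 2)}} (begin-strict
    ℕ→ℚ 2 * (a + b)              ≡⟨ *-distribˡ-+ (ℕ→ℚ 2) a b ⟩
    ℕ→ℚ 2 * a + ℕ→ℚ 2 * b        <⟨ +-mono-<-≤ 2a<1 2b≤1 ⟩
    1ℚ + 1ℚ                      ≡⟨ *-identityʳ (ℕ→ℚ 2) ⟨
    ℕ→ℚ 2 * 1ℚ                   ∎)
    where open ≤-Reasoning

  -- The paper's choice p = 3q/r, where r = mₖ/(nₖ + t d + 2) = mk/(2 + X).
  choice-of-p : ∀ k m s nk mk X n N q → nk ℕ.≤ X → 2 ℕ.≤ n → 0ℚ < q → ℕ→ℚ n < expPartial q N →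
    0ℚ < + mk / (2 ℕ.+ X) → q ^ℚ m * ℕ→ℚ n ^ℚ s < C₀ k m * (+ mk / (2 ℕ.+ X)) ^ℚ m →
    Σ ℚ λ p → 0ℚ ≤ p × p ≤ 1ℚ × ℕ→ℚ (suc k) * (ℕ→ℚ n ^ℚ s * p ^ℚ m) + ℕ→ℚ n ^ℚ nk * (1ℚ - p) ^ℚ mk < 1ℚ
  choice-of-p k m s nk mk X n N q nk≤X 2≤n 0<q n<eq 0<r small =
    p , 0≤p , p≤1′ , +<1-from-halves {ℕ→ℚ (suc k) * (ℕ→ℚ n ^ℚ s * p ^ℚ m)} (2*[1+k]*Y<1 k m Y<3^mC₀)
                          (lastColour-bound n nk mk X N nk≤X 2≤n 0≤q n<eq 0≤p p≤1′ 3q[2+X]≤p*mk)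
    where
    r = + mk / (2 ℕ.+ X)
    instance
      r≢0 : NonZero r
      r≢0 = pos⇒nonZero r {{positive 0<r}}
    0≤q = <⇒≤ 0<q
    p = ℕ→ℚ 3 * q * 1/ r
    0≤p : 0ℚ ≤ p
    0≤p = *-nonNeg (*-nonNeg (ℕ→ℚ-nonNeg 3) 0≤q) (<⇒≤ (positive⁻¹ (1/ r) {{1/pos⇒pos r {{positive 0<r}}}}))
    pr≡3q : p * r ≡ ℕ→ℚ 3 * q
    pr≡3q = trans (*-assoc (ℕ→ℚ 3 * q) (1/ r) r) (trans (cong (ℕ→ℚ 3 * q *_) (*-inverseˡ r)) (*-identityʳ _))
    Y<3^mC₀ = n^s*p^m<3^m*C n s m 0<r pr≡3q small
    p≤1′ = n^s*p^m<1⇒p≤1 n s m (ℕ.≤-trans (ℕ.s≤s ℕ.z≤n) 2≤n) (<-≤-trans Y<3^mC₀ (3^m*C₀≤1 k m))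
    3q[2+X]≤p*mk : ℕ→ℚ 3 * q * ℕ→ℚ (2 ℕ.+ X) ≤ p * ℕ→ℚ mk
    3q[2+X]≤p*mk = ≤-reflexive (begin
      ℕ→ℚ 3 * q * ℕ→ℚ (2 ℕ.+ X)   ≡⟨ cong (_* ℕ→ℚ (2 ℕ.+ X)) pr≡3q ⟨
      p * r * ℕ→ℚ (2 ℕ.+ X)       ≡⟨ *-assoc p r _ ⟩
      p * (r * ℕ→ℚ (2 ℕ.+ X))     ≡⟨ cong (p *_) (/-*-cancel mk (suc X)) ⟩
      p * ℕ→ℚ mk                  ∎)
      where open ≡-Reasoning

module FinFamilies where
  open import Data.Nat as ℕ using (ℕ; zero; suc)
  import Data.Nat.Properties as ℕ
  open import Data.Fin using (Fin; zero; suc; inject₁; fromℕ)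
  open import Function using (_∘_)
  open import Relation.Binary.PropositionalEquality using (_≡_; refl)

  _∷ʳ_ : ∀ {A : Set} {n} → (Fin n → A) → A → Fin (suc n) → A
  _∷ʳ_ {n = zero}  xs x _       = x
  _∷ʳ_ {n = suc n} xs x zero    = xs zero
  _∷ʳ_ {n = suc n} xs x (suc i) = ((xs ∘ suc) ∷ʳ x) i

  ∷ʳ-inject₁ : ∀ {A : Set} {n} (xs : Fin n → A) x i → (xs ∷ʳ x) (inject₁ i) ≡ xs i
  ∷ʳ-inject₁ {n = suc n} xs x zero    = refl
  ∷ʳ-inject₁ {n = suc n} xs x (suc i) = ∷ʳ-inject₁ (xs ∘ suc) x i

  ∷ʳ-fromℕ : ∀ {A : Set} {n} (xs : Fin n → A) x → (xs ∷ʳ x) (fromℕ n) ≡ x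
  ∷ʳ-fromℕ {n = zero}  xs x = refl
  ∷ʳ-fromℕ {n = suc n} xs x = ∷ʳ-fromℕ (xs ∘ suc) x

  ∷ʳ-all : ∀ {A : Set} {P : A → Set} {n} {xs : Fin n → A} {x} → (∀ i → P (xs i)) → P x → ∀ i → P ((xs ∷ʳ x) i)
  ∷ʳ-all {n = zero}  Pxs Px _       = Px
  ∷ʳ-all {n = suc n} Pxs Px zero    = Pxs zero
  ∷ʳ-all {P = P} {n = suc n} Pxs Px (suc i) = ∷ʳ-all {P = P} (Pxs ∘ suc) Px i

  minFin-≤ : ∀ {k} (f : Fin (suc k) → ℕ) i → minFin f ℕ.≤ f i
  minFin-≤ {zero}  f zero    = ℕ.≤-refl
  minFin-≤ {suc k} f zero    = ℕ.m⊓n≤m _ _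
  minFin-≤ {suc k} f (suc i) = ℕ.≤-trans (ℕ.m⊓n≤n (f zero) _) (minFin-≤ (f ∘ suc) i)


module BiasedColouring
  (k t : ℕ) (Ps : Fin (suc k) → FinPoset) (Pk : FinPoset)
  {p : ℚ} (0≤p : 0ℚ ℚ.≤ p) (p≤1 : p ℚ.≤ 1ℚ) where

  open import Data.Nat as ℕ using (zero)
  open import Data.Fin using (zero; suc; inject₁; fromℕ)
  open import Data.Product using (Σ; _×_; _,_; map₂)
  open import Function using (_∘_)
  open import Relation.Nullary using (¬_)
  open import Data.Rational
  open import Data.Rational.Properties
  open import Data.Rational.Solver using (module +-*-Solver)
  open +-*-Solver
  open import Relation.Binary.PropositionalEquality
  open RationalArithmetic
  open ExponentialSeries using (1/suc; 1/suc-nonNeg; 1/suc-*-cancel; 1/suc≤1)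
  open WeightedSums
  open FinFamilies

  a : ℚ
  a = p * 1/suc k

  0≤a : 0ℚ ≤ a
  0≤a = *-nonNeg 0≤p (1/suc-nonNeg k)

  w : Fin (suc (suc k)) → ℚ
  w = (λ _ → a) ∷ʳ (1ℚ - p)

  ∑w≡1 : sum w ≡ 1ℚ
  ∑w≡1 = begin
    sum w                                     ≡⟨ sum-init-last w ⟩
    ∑[ i < suc k ] w (inject₁ i) + w (fromℕ (suc k))
      ≡⟨ cong₂ _+_ (sum-cong-≗ (∷ʳ-inject₁ {n = suc k} (λ _ → a) (1ℚ - p))) (∷ʳ-fromℕ {n = suc k} (λ _ → a) (1ℚ - p)) ⟩
    ∑[ i < suc k ] a + (1ℚ - p)               ≡⟨ cong (_+ (1ℚ - p)) (sum-const (suc k) a) ⟩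
    ℕ→ℚ (suc k) * (p * 1/suc k) + (1ℚ - p)
      ≡⟨ solve 3 (λ n p u → n :* (p :* u) :+ (con 1ℚ :- p) := p :* (u :* n) :+ (con 1ℚ :- p)) refl (ℕ→ℚ (suc k)) p (1/suc k) ⟩
    p * (1/suc k * ℕ→ℚ (suc k)) + (1ℚ - p)    ≡⟨ cong (λ z → p * z + (1ℚ - p)) (1/suc-*-cancel k) ⟩
    p * 1ℚ + (1ℚ - p)                         ≡⟨ solve 1 (λ p → p :* con 1ℚ :+ (con 1ℚ :- p) := con 1ℚ) refl p ⟩
    1ℚ                                        ∎
    where open ≡-Reasoning

  w-nonNeg : ∀ i → 0ℚ ≤ w i
  w-nonNeg = ∷ʳ-all {P = 0ℚ ≤_} (λ _ → 0≤a) (1-p-nonNeg p≤1)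

  Ps′ : Fin (suc (suc k)) → FinPoset
  Ps′ = Ps ∷ʳ Pk

  expectedCopies≤ : ∀ n s m → 1 ℕ.≤ n → (∀ i → size (Ps i) ℕ.≤ s) → (∀ i → m ℕ.≤ numChains (Ps i) t) →
    ∑[ i < suc (suc k) ] (ℕ→ℚ n ^ℚ size (Ps′ i) * w i ^ℚ numChains (Ps′ i) t)
      ≤ ℕ→ℚ (suc k) * (ℕ→ℚ n ^ℚ s * p ^ℚ m) + ℕ→ℚ n ^ℚ size Pk * (1ℚ - p) ^ℚ numChains Pk t
  expectedCopies≤ n s m 1≤n |Pᵢ|≤s m≤mᵢ = begin
    sum copies                                                   ≡⟨ sum-init-last copies ⟩
    ∑[ i < suc k ] copies (inject₁ i) + copies (fromℕ (suc k))
      ≤⟨ +-mono-≤ (sum-mono-≤ {f = copies ∘ inject₁} {g = λ _ → Y} copies≤Y) (≤-reflexive last≡Z) ⟩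
    ∑[ i < suc k ] Y + Z                                         ≡⟨ cong (_+ Z) (sum-const (suc k) Y) ⟩
    ℕ→ℚ (suc k) * Y + Z                                          ∎
    where
    open ≤-Reasoning
    copies : Fin (suc (suc k)) → ℚ
    copies i = ℕ→ℚ n ^ℚ size (Ps′ i) * w i ^ℚ numChains (Ps′ i) t
    Y = ℕ→ℚ n ^ℚ s * p ^ℚ m
    Z = ℕ→ℚ n ^ℚ size Pk * (1ℚ - p) ^ℚ numChains Pk t
    copies-at : ∀ P v → ℚ
    copies-at P v = ℕ→ℚ n ^ℚ size P * v ^ℚ numChains P t
    copies≤Y : ∀ i → copies (inject₁ i) ≤ Y
    copies≤Y i = begin
      copies (inject₁ i)
        ≡⟨ cong₂ copies-at (∷ʳ-inject₁ Ps Pk i) (∷ʳ-inject₁ {n = suc k} (λ _ → a) (1ℚ - p) i) ⟩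
      ℕ→ℚ n ^ℚ size (Ps i) * a ^ℚ numChains (Ps i) t
        ≤⟨ *-mono-≤-0≤ (^ℚ-nonNeg (size (Ps i)) (ℕ→ℚ-nonNeg n)) (^ℚ-nonNeg (numChains (Ps i) t) 0≤a)
             (^ℚ-monoʳ-≤ (ℕ→ℚ-mono-≤ {1} {n} 1≤n) (|Pᵢ|≤s i))
             (≤-trans (^ℚ-monoˡ-≤ (numChains (Ps i) t) 0≤a a≤p) (^ℚ-antimonoʳ-≤ 0≤p p≤1 (m≤mᵢ i))) ⟩
      Y ∎
      where
      a≤p : a ≤ p
      a≤p = ≤-trans (*-monoˡ-≤-0≤ 0≤p (1/suc≤1 k)) (≤-reflexive (*-identityʳ p))
    last≡Z : copies (fromℕ (suc k)) ≡ Z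
    last≡Z = cong₂ copies-at (∷ʳ-fromℕ Ps Pk) (∷ʳ-fromℕ {n = suc k} (λ _ → a) (1ℚ - p))

  colouring-without-copies : ∀ Q s m → 1 ℕ.≤ size Q → (∀ i → size (Ps i) ℕ.≤ s) → (∀ i → m ℕ.≤ numChains (Ps i) t) →
    ℕ→ℚ (suc k) * (ℕ→ℚ (size Q) ^ℚ s * p ^ℚ m) + ℕ→ℚ (size Q) ^ℚ size Pk * (1ℚ - p) ^ℚ numChains Pk t < 1ℚ →
    Σ (Coloring Q (suc (suc k))) λ c →
      (∀ i → ¬ MonoCopy (Ps i) Q t c (inject₁ i)) × ¬ MonoCopy Pk Q t c (fromℕ (suc k))
  colouring-without-copies Q s m 1≤n |Pᵢ|≤s m≤mᵢ E<1 =
    map₂ (λ {c} → split c) (colouring-without-monochromatic-copies t Q w w-nonNeg ∑w≡1 Ps′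
      (≤-<-trans (expectedCopies≤ (size Q) s m 1≤n |Pᵢ|≤s m≤mᵢ) E<1))
    where
    open MonochromaticCopies using (colouring-without-monochromatic-copies)
    split : ∀ c → (∀ i → ¬ MonoCopy (Ps′ i) Q t c i) →
            (∀ i → ¬ MonoCopy (Ps i) Q t c (inject₁ i)) × ¬ MonoCopy Pk Q t c (fromℕ (suc k))
    split c none =
      (λ i → subst (λ P → ¬ MonoCopy P Q t c (inject₁ i)) (∷ʳ-inject₁ Ps Pk i) (none (inject₁ i))) ,
      subst (λ P → ¬ MonoCopy P Q t c (fromℕ (suc k))) (∷ʳ-fromℕ Ps Pk) (none (fromℕ (suc k)))

open import Data.Nat using (_+_; _*_; _∸_; _≤_; _<_; _≤?_; s≤s; z≤n)
open import Data.Nat.Combinatorics using (_C_)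
import Data.Nat.Properties as ℕ
open import Data.Fin.Properties using (≤fromℕ; pigeonhole; <-irrefl)
open import Function using (case_of_)
open import Relation.Nullary using (yes; no)
open Estimates using (C₀; C₀-pos; choice-of-p)
open FinFamilies using (minFin-≤)

no-monoCopy-into-smaller : ∀ P Q t {K} (c : Coloring Q K) i → size Q < size P → ¬ MonoCopy P Q t c i
no-monoCopy-into-smaller P Q t c i |Q|<|P| (f , (f-injective , _) , _)
  with x , y , x<y , fx≡fy ← pigeonhole |Q|<|P| f = <-irrefl (f-injective fx≡fy) x<y

theorem2p1 :
    (k₂ t : ℕ) → 2 ≤ t →
    (Ps : Fin (suc k₂) → FinPoset) →
    (∀ i → EveryElemInChain (Ps i) t) →
    t ≤ size (Ps zero) →
    (∀ i j → i Fin.≤ j → size (Ps i) ≤ size (Ps j)) →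
    1 ≤ minFin (λ i → numChains (Ps i) t) →
    ∃ λ (C₀ : ℚ) → 0ℚ ℚ.< C₀ ×
      ((Pk : FinPoset) → EveryElemInChain Pk t →
        size (Ps (fromℕ k₂)) ≤ size Pk → 3 ≤ size Pk →
        (n : ℕ) → 1 ≤ n →
        LnLt n ((+ numChains Pk t) / (2 + (size Pk + t * ((size Pk C t) ∸ numChains Pk t)))) →
        (∃ λ (q : ℚ) → LnLt n q ×
          ((q ^ℚ minFin (λ i → numChains (Ps i) t)) ℚ.* (ℕ→ℚ n ^ℚ size (Ps (fromℕ k₂)))
            ℚ.< C₀ ℚ.* (((+ numChains Pk t) / (2 + (size Pk + t * ((size Pk C t) ∸ numChains Pk t))))
                        ^ℚ minFin (λ i → numChains (Ps i) t)))) →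
        (Q : FinPoset) → size Q ≡ n →
        Σ (Coloring Q (suc (suc k₂))) λ c →
          (∀ (i : Fin (suc k₂)) → ¬ MonoCopy (Ps i) Q t c (inject₁ i)) ×
          ¬ MonoCopy Pk Q t c (fromℕ (suc k₂)))
theorem2p1 k₂ t 2≤t Ps _ t≤|P₀| |Pᵢ|-mono _ = C₀ k₂ m , C₀-pos k₂ m ,
  λ { Pk _ _ 3≤|Pk| n _ (0<r , _) (q , (0<q , N , n<eq) , small) Q refl → case 2 ≤? size Q of λ
    { (yes 2≤|Q|) →
        let p , 0≤p , p≤1 , E<1 = choice-of-p k₂ m s (size Pk) (numChains Pk t)
                                    (size Pk + t * (size Pk C t ∸ numChains Pk t)) (size Q) N q
                                    (ℕ.m≤m+n _ _) 2≤|Q| 0<q n<eq 0<r small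
        in BiasedColouring.colouring-without-copies k₂ t Ps Pk 0≤p p≤1 Q s m (ℕ.≤-trans (s≤s z≤n) 2≤|Q|)
             (λ i → |Pᵢ|-mono i (fromℕ k₂) (≤fromℕ i)) (minFin-≤ (λ i → numChains (Ps i) t)) E<1
    ; (no |Q|≱2) →
        (λ _ → zero) ,
        (λ i → no-monoCopy-into-smaller (Ps i) Q t _ _ (ℕ.<-≤-trans (ℕ.≰⇒> |Q|≱2) (2≤|Pᵢ| i))) ,
        no-monoCopy-into-smaller Pk Q t _ _ (ℕ.<-≤-trans (ℕ.≰⇒> |Q|≱2) (ℕ.≤-trans (ℕ.n≤1+n 2) 3≤|Pk|)) } }
  where
  m = minFin (λ i → numChains (Ps i) t)
  s = size (Ps (fromℕ k₂))
  2≤|Pᵢ| : ∀ i → 2 ≤ size (Ps i)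
  2≤|Pᵢ| i = ℕ.≤-trans 2≤t (ℕ.≤-trans t≤|P₀| (|Pᵢ|-mono zero i z≤n))
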